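{- Let $n\ge1$. (a) If either $0\le k<n/2$ and $1\le j\le n$, or $k=n/2$ and $n/2<j\le n$, then $b(n,k,j-1)\ge b(n,k,j)$; this inequality is strict unless either $k=0$ and $2\le j\le n$, or $n$ is odd, $k=(n-1)/2$ and $j=1$. (b) If either $1\le k\le n/2$ and $0\le j\le n$, or $n$ is odd, $k=(n+1)/2$ and $(n+1)/2\le j\le n$, then $b(n,k-1,j)\le b(n,k,j)$; this inequality is strict unless $n$ is even, $k=n/2$ and $j=0$. (c) The array $b(n,k,j)$, $0\le j,k\le n$, is unimodal with respect to the order $\preceq$, with maximal value $b(n,n/2,n/2)$ if $n$ is even and $b(n,(n-1)/2,0)=b(n,(n+1)/2,n)$ if $n$ is odd.
   Context: $\mathcal{B}_n$ is the set of signed permutations of order $n$: bijections $\sigma$ of $\{ -n,\ldots,n\}$ with $\sigma(-i)=-\sigma(i)$, identified with $(0,\sigma_1,\ldots,\sigma_n)$; $\mathrm{des}(\sigma)$ is the number of $i\in\{1,\ldots,n\}$ with $\sigma_{i-1}>\sigma_i$ ($\sigma_0=0$). For $0\le j,k\le n$, $b(n,k,j)$ is the number of $\sigma\in\mathcal{B}_n$ with $\mathrm{des}(\sigma)=k$ such that for every $1\le i\le n$, $\sigma_i<0$ iff $|\sigma_i|\in\{1,\ldots,j\}$. The linear order $\preceq$ on $\{0,1,\ldots,n\}^2$ is defined by $(k_1,j_1)\preceq(k_2,j_2)$ iff either $k_1<k_2$, or $k_1=k_2$ and $j_1\ge j_2$. Unimodal with respect to $\preceq$ means that, listing the values $b(n,k,j)$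 in increasing $\preceq$-order of $(k,j)$, the resulting sequence is weakly increasing and then weakly decreasing. -}

module Defs where

open import Data.Bool using (Bool)
import Data.Bool.Properties as BoolP
open import Data.Nat using (ℕ; zero; suc; _+_; _≤_; _≥_; _≤?_)
import Data.Nat.Properties as ℕP
open import Data.Integer as ℤ using (ℤ; +_; -[1+_]; ∣_∣; _<?_)
open import Data.List using (List; []; _∷_; [_]; map; concatMap; upTo; reverse; length; filter; take; drop)
open import Data.List.Relation.Unary.All using (All)
open import Data.List.Relation.Unary.All.Properties using ()
import Data.List.Relation.Unary.All as All
open import Data.List.Relation.Unary.Linked using (Linked)
open import Data.List.Relation.Unary.Unique.DecPropositional ℕP._≟_ using (Unique; unique?)
open import Data.Product using (∃; _×_)
open import Relation.Nullary using (does; Dec)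
open import Relation.Binary.PropositionalEquality using (_≡_)

-- Signed permutations of order n are represented by their window
-- notation  (σ₁, …, σₙ)  as a list of integers (σ₀ = 0 is implicit).

signedValues : ℕ → List ℤ
signedValues n = concatMap (λ m → (+ suc m) ∷ -[1+ m ] ∷ []) (upTo n)

words : List ℤ → ℕ → List (List ℤ)
words vs zero    = [ [] ]
words vs (suc l) = concatMap (λ v → map (v ∷_) (words vs l)) vs

-- B n : all signed permutations of order n, i.e. words σ₁…σₙ with
-- σᵢ ∈ {±1,…,±n} whose absolute values |σ₁|,…,|σₙ| are pairwise distinct
-- (equivalently, i ↦ |σᵢ| is a bijection of {1,…,n}).
B : ℕ → List (List ℤ)
B n = filter (λ w → unique? (map ∣_∣ w)) (words (signedValues n) n)

desFrom : ℤ → List ℤ → ℕ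
desFrom a []      = 0
desFrom a (x ∷ w) = (if does (x <? a) then 1 else 0) + desFrom x w
  where open import Data.Bool using (if_then_else_)

des : List ℤ → ℕ
des w = desFrom (+ 0) w

-- the sign condition for parameter j:  σᵢ < 0  iff  |σᵢ| ∈ {1,…,j}
-- (every entry is nonzero, so |σᵢ| ∈ {1..j} iff |σᵢ| ≤ j)
SignOK : ℕ → ℤ → Set
SignOK j x = does (x <? + 0) ≡ does (∣ x ∣ ≤? j)

SignPattern : ℕ → List ℤ → Set
SignPattern j w = All (SignOK j) w

b : ℕ → ℕ → ℕ → ℕ
b n k j = length (filter (λ w → (des w ℕP.≟ k) ×-dec All.all? (signOK? j) w) (B n))
  where
  open import Relation.Nullary.Decidable using (_×-dec_)
  signOK? : (j : ℕ) → (x : ℤ) → Dec (SignOK j x)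
  signOK? j x = does (x <? + 0) BoolP.≟ does (∣ x ∣ ≤? j)

Unimodal : List ℕ → Set
Unimodal xs = ∃ λ m → Linked _≤_ (take (suc m) xs) × Linked _≥_ (drop m xs)

-- the values b(n,k,j), 0 ≤ j,k ≤ n, listed in increasing ⪯-order
-- ((k₁,j₁) ⪯ (k₂,j₂) iff k₁ < k₂, or k₁ = k₂ and j₁ ≥ j₂):
-- k increasing, and for fixed k, j decreasing from n to 0.
bSequence : ℕ → List ℕ
bSequence n = concatMap (λ k → map (λ j → b n k j) (reverse (upTo (suc n)))) (upTo (suc n))

-- Fix j.  Reading a signed permutation σ₁ … σₙ with the prescribed signs from left to right, the
-- letters still available at each step form a totally ordered set, and whether the next letter makes
-- a descent depends only on its rank there compared with the rank of the previous letter (σ₀ = 0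
-- exceeds exactly the j negative letters).  Hence b(n,k,j) = F n k j, where
-- F (l+1) k ρ = Σ_{t ≤ l} F l (k − [t < ρ]) t.  Reversing the alphabet gives the symmetry
-- F l k ρ = F l (l−k) (l−ρ), and comparing the recurrence at ρ and ρ+1 gives
-- F (l+1) k ρ − F (l+1) k (ρ+1) = F l k ρ − F l (k−1) ρ.  So (a) at length l+1 is (b) at length l,
-- while (b) at length l+1 follows from (a) and (b) at length l by comparing the recurrence sums term
-- by term, after reflecting part of the sum near the centre.  Finally, rows with 2k < n rise as j
-- decreases, rows with 2k > n fall by symmetry, and consecutive rows meet in the equal values
-- F n k 0 = F n (k+1) n; this gives unimodality and locates the maxima.

module Submission where

open import Defs
open import Data.Bool using (Bool; true; false; _∧_; not; if_then_else_)
import Data.Bool.Properties as Boolₚ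
open import Data.Bool.ListAction using (all; any)
open import Data.Empty using (⊥-elim)
open import Data.Fin using (#_)
open import Data.Integer as ℤ using (ℤ; +0; +[1+_]; -[1+_]; ∣_∣)
import Data.Integer.Properties as ℤₚ
open import Data.List using (List; []; _∷_; [_]; map; concatMap; _++_; upTo; applyUpTo; applyDownFrom; downFrom; reverse; length; filter; take; drop)
import Data.List.Properties as Listₚ
open import Data.List.Membership.Propositional using (_∈_)
import Data.List.Relation.Unary.All as All
open import Data.List.Relation.Unary.Any using (here; there)
open import Data.List.Relation.Unary.Linked using (Linked; []; [-]; _∷_)
open import Data.List.Relation.Unary.Linked.Properties using (applyDownFrom⁺₁)
open import Data.Nat using (ℕ; zero; suc; _+_; _*_; _∸_; _≤_; _<_; _≥_; z≤n; s≤s; _≡ᵇ_; _<?_; _≤?_)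
import Data.Nat.Properties as ℕₚ
open import Data.Nat.Tactic.RingSolver using (solve-∀)
open import Data.List.Relation.Unary.Unique.DecPropositional ℕₚ._≟_ using (unique?)
open import Data.Product using (∃-syntax; _×_; _,_; proj₁; proj₂)
open import Data.Sum using (_⊎_; inj₁; inj₂)
open import Data.Vec using ([]; _∷_)
open import Function using (_∘_)
open import Relation.Binary.Definitions using (tri<; tri≈; tri>)
open import Relation.Binary.PropositionalEquality using (module ≡-Reasoning; _≡_; _≢_; refl; sym; trans; cong; cong₂; subst; subst₂)
open import Relation.Nullary using (¬_; Dec; yes; no; does)
open import Relation.Nullary.Decidable using (dec-true; dec-false)
open import Algebra.Properties.CommutativeSemigroup ℕₚ.+-commutativeSemigroup using (interchange; xy∙z≈xz∙y; xy∙z≈zy∙x)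
open import Algebra.Solver.CommutativeMonoid Boolₚ.∧-commutativeMonoid using (Expr; prove; var; _⊕_)

private variable
  A : Set

does-true⇒ : ∀ {P : Set} (P? : Dec P) → does P? ≡ true → P
does-true⇒ (yes p) _ = p

false≢true : false ≢ true
false≢true ()

∧-true⇒left : ∀ {a b} → a ∧ b ≡ true → a ≡ true
∧-true⇒left {true} _ = refl

∧-true⇒right : ∀ {a b} → a ∧ b ≡ true → b ≡ true
∧-true⇒right {true} b≡true = b≡true

indicator : Bool → ℕ
indicator c = if c then 1 else 0

indicator-mono : ∀ {a b} → (a ≡ true → b ≡ true) → indicator a ≤ indicator b
indicator-mono {false} _   = z≤n
indicator-mono {true}  a⇒b rewrite a⇒b refl = ℕₚ.≤-refl

sumList : (A → ℕ) → List A → ℕ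
sumList f []       = 0
sumList f (x ∷ xs) = f x + sumList f xs

count : (A → Bool) → List A → ℕ
count p = sumList (λ x → indicator (p x))

sumList-cong∈ : ∀ {f g : A → ℕ} xs → (∀ x → x ∈ xs → f x ≡ g x) → sumList f xs ≡ sumList g xs
sumList-cong∈ []       f≡g = refl
sumList-cong∈ (x ∷ xs) f≡g = cong₂ _+_ (f≡g x (here refl)) (sumList-cong∈ xs (λ y y∈ → f≡g y (there y∈)))

sumList-cong : ∀ {f g : A → ℕ} xs → (∀ x → f x ≡ g x) → sumList f xs ≡ sumList g xs
sumList-cong xs f≡g = sumList-cong∈ xs (λ x _ → f≡g x)

count-cong∈ : ∀ {p q : A → Bool} xs → (∀ x → x ∈ xs → p x ≡ q x) → count p xs ≡ count q xs
count-cong∈ xs p≡q = sumList-cong∈ xs (λ x x∈ → cong indicator (p≡q x x∈))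

count-cong : ∀ {p q : A → Bool} xs → (∀ x → p x ≡ q x) → count p xs ≡ count q xs
count-cong xs p≡q = count-cong∈ xs (λ x _ → p≡q x)

sumList-+ : ∀ (f g : A → ℕ) xs → sumList (λ x → f x + g x) xs ≡ sumList f xs + sumList g xs
sumList-+ f g []       = refl
sumList-+ f g (x ∷ xs) = trans (cong (f x + g x +_) (sumList-+ f g xs)) (interchange (f x) (g x) _ _)

sumList-++ : ∀ (f : A → ℕ) xs ys → sumList f (xs ++ ys) ≡ sumList f xs + sumList f ys
sumList-++ f []       ys = refl
sumList-++ f (x ∷ xs) ys = trans (cong (f x +_) (sumList-++ f xs ys)) (sym (ℕₚ.+-assoc (f x) _ _))

sumList-map : ∀ {X : Set} (f : X → ℕ) (g : A → X) xs → sumList f (map g xs) ≡ sumList (λ x → f (g x)) xs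
sumList-map f g []       = refl
sumList-map f g (x ∷ xs) = cong (f (g x) +_) (sumList-map f g xs)

sumList-concatMap : ∀ {X : Set} (f : X → ℕ) (g : A → List X) xs →
                    sumList f (concatMap g xs) ≡ sumList (λ x → sumList f (g x)) xs
sumList-concatMap f g []       = refl
sumList-concatMap f g (x ∷ xs) = trans (sumList-++ f (g x) (concatMap g xs)) (cong (sumList f (g x) +_) (sumList-concatMap f g xs))

sumList-*ʳ : ∀ (f : A → ℕ) y xs → sumList (λ x → f x * y) xs ≡ sumList f xs * y
sumList-*ʳ f y []       = refl
sumList-*ʳ f y (x ∷ xs) = trans (cong (_+_ (f x * y)) (sumList-*ʳ f y xs)) (sym (ℕₚ.*-distribʳ-+ y (f x) _))

sumList-zero∈ : ∀ (f : A → ℕ) xs → (∀ x → x ∈ xs → f x ≡ 0) → sumList f xs ≡ 0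
sumList-zero∈ f []       f≡0 = refl
sumList-zero∈ f (x ∷ xs) f≡0 rewrite f≡0 x (here refl) = sumList-zero∈ f xs (λ y y∈ → f≡0 y (there y∈))

sumList≡0⇒ : ∀ (f : A → ℕ) xs → sumList f xs ≡ 0 → ∀ x → x ∈ xs → f x ≡ 0
sumList≡0⇒ f (y ∷ xs) s≡0 x (here refl) = ℕₚ.m+n≡0⇒m≡0 (f y) s≡0
sumList≡0⇒ f (y ∷ xs) s≡0 x (there x∈) = sumList≡0⇒ f xs (ℕₚ.m+n≡0⇒n≡0 (f y) s≡0) x x∈

sumList-mono∈ : ∀ (f g : A → ℕ) xs → (∀ x → x ∈ xs → f x ≤ g x) → sumList f xs ≤ sumList g xs
sumList-mono∈ f g []       f≤g = z≤n
sumList-mono∈ f g (x ∷ xs) f≤g = ℕₚ.+-mono-≤ (f≤g x (here refl)) (sumList-mono∈ f g xs (λ y y∈ → f≤g y (there y∈)))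

sumList-mono-<∈ : ∀ (f g : A → ℕ) xs → (∀ x → x ∈ xs → f x ≤ g x) → ∀ y → y ∈ xs → f y < g y → sumList f xs < sumList g xs
sumList-mono-<∈ f g (x ∷ xs) f≤g y (here refl) fy<gy = ℕₚ.+-mono-<-≤ fy<gy (sumList-mono∈ f g xs (λ z z∈ → f≤g z (there z∈)))
sumList-mono-<∈ f g (x ∷ xs) f≤g y (there y∈) fy<gy =
  ℕₚ.+-mono-≤-< (f≤g x (here refl)) (sumList-mono-<∈ f g xs (λ z z∈ → f≤g z (there z∈)) y y∈ fy<gy)

count-zero : ∀ (p : A → Bool) xs → (∀ x → p x ≡ false) → count p xs ≡ 0
count-zero p xs p≡false = sumList-zero∈ _ xs (λ x _ → cong indicator (p≡false x))

count≡0⇒ : ∀ (p : A → Bool) xs → count p xs ≡ 0 → ∀ x → x ∈ xs → p x ≡ false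
count≡0⇒ p xs c≡0 x x∈ with p x | sumList≡0⇒ _ xs c≡0 x x∈
... | false | _ = refl

count-const-∧ : ∀ c (q : A → Bool) xs → count (λ x → c ∧ q x) xs ≡ (if c then count q xs else 0)
count-const-∧ true  q xs = refl
count-const-∧ false q xs = count-zero _ xs (λ _ → refl)

count-split : ∀ (p q : A → Bool) xs → count p xs ≡ count (λ x → p x ∧ q x) xs + count (λ x → p x ∧ not (q x)) xs
count-split p q xs = trans (sumList-cong xs split) (sumList-+ _ _ xs)
  where
  split : ∀ x → indicator (p x) ≡ indicator (p x ∧ q x) + indicator (p x ∧ not (q x))
  split x with p x | q x
  ... | false | _     = refl
  ... | true  | true  = refl
  ... | true  | false = refl

count-mono∈ : ∀ (p q : A → Bool) xs → (∀ x → x ∈ xs → p x ≡ true → q x ≡ true) → count p xs ≤ count q xs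
count-mono∈ p q xs p⇒q = sumList-mono∈ _ _ xs (λ x x∈ → indicator-mono (p⇒q x x∈))

count-mono-<∈ : ∀ (p q : A → Bool) xs → (∀ x → x ∈ xs → p x ≡ true → q x ≡ true) →
                ∀ y → y ∈ xs → p y ≡ false → q y ≡ true → count p xs < count q xs
count-mono-<∈ p q xs p⇒q y y∈ py qy = sumList-mono-<∈ _ _ xs (λ x x∈ → indicator-mono (p⇒q x x∈)) y y∈ (lt py qy)
  where
  lt : ∀ {a b} → a ≡ false → b ≡ true → indicator a < indicator b
  lt refl refl = s≤s z≤n

∑< : ℕ → (ℕ → ℕ) → ℕ
∑< zero    f = 0
∑< (suc c) f = ∑< c f + f c

∑<-cong : ∀ c {f g : ℕ → ℕ} → (∀ t → t < c → f t ≡ g t) → ∑< c f ≡ ∑< c g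
∑<-cong zero    f≡g = refl
∑<-cong (suc c) f≡g = cong₂ _+_ (∑<-cong c (λ t t<c → f≡g t (ℕₚ.m<n⇒m<1+n t<c))) (f≡g c ℕₚ.≤-refl)

∑<-mono : ∀ c {f g : ℕ → ℕ} → (∀ t → t < c → f t ≤ g t) → ∑< c f ≤ ∑< c g
∑<-mono zero    f≤g = z≤n
∑<-mono (suc c) f≤g = ℕₚ.+-mono-≤ (∑<-mono c (λ t t<c → f≤g t (ℕₚ.m<n⇒m<1+n t<c))) (f≤g c ℕₚ.≤-refl)

∑<-mono-< : ∀ c {f g : ℕ → ℕ} → (∀ t → t < c → f t ≤ g t) → ∀ s → s < c → f s < g s → ∑< c f < ∑< c g
∑<-mono-< (suc c) f≤g s s<1+c fs<gs with s ℕₚ.≟ c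
... | yes refl = ℕₚ.+-mono-≤-< (∑<-mono c (λ t t<c → f≤g t (ℕₚ.m<n⇒m<1+n t<c))) fs<gs
... | no  s≢c  = ℕₚ.+-mono-<-≤ (∑<-mono-< c (λ t t<c → f≤g t (ℕₚ.m<n⇒m<1+n t<c)) s (ℕₚ.≤∧≢⇒< (ℕₚ.≤-pred s<1+c) s≢c) fs<gs)
                               (f≤g c ℕₚ.≤-refl)

∑<-zero : ∀ c {f : ℕ → ℕ} → (∀ t → t < c → f t ≡ 0) → ∑< c f ≡ 0
∑<-zero zero    f≡0 = refl
∑<-zero (suc c) f≡0 = cong₂ _+_ (∑<-zero c (λ t t<c → f≡0 t (ℕₚ.m<n⇒m<1+n t<c))) (f≡0 c ℕₚ.≤-refl)

term≤∑< : ∀ c (f : ℕ → ℕ) {t} → t < c → f t ≤ ∑< c f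
term≤∑< (suc c) f {t} t<1+c with t ℕₚ.≟ c
... | yes refl = ℕₚ.m≤n+m (f t) (∑< c f)
... | no  t≢c  = ℕₚ.≤-trans (term≤∑< c f (ℕₚ.≤∧≢⇒< (ℕₚ.≤-pred t<1+c) t≢c)) (ℕₚ.m≤m+n _ _)

∑<-+ : ∀ a c (f : ℕ → ℕ) → ∑< (a + c) f ≡ ∑< a f + ∑< c (λ i → f (a + i))
∑<-+ a zero    f = trans (cong (λ x → ∑< x f) (ℕₚ.+-identityʳ a)) (sym (ℕₚ.+-identityʳ _))
∑<-+ a (suc c) f = trans (cong (λ x → ∑< x f) (ℕₚ.+-suc a c))
                         (trans (cong (_+ f (a + c)) (∑<-+ a c f)) (ℕₚ.+-assoc (∑< a f) _ _))

∑<-reverse : ∀ c (f : ℕ → ℕ) → ∑< c (λ i → f (c ∸ suc i)) ≡ ∑< c f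
∑<-reverse zero    f = refl
∑<-reverse (suc c) f = trans (∑<-head c (λ i → f (c ∸ i)))
                             (trans (cong (f c +_) (∑<-reverse c f)) (ℕₚ.+-comm (f c) (∑< c f)))
  where
  ∑<-head : ∀ c (g : ℕ → ℕ) → ∑< (suc c) g ≡ g 0 + ∑< c (λ i → g (suc i))
  ∑<-head zero    g = sym (ℕₚ.+-identityʳ (g 0))
  ∑<-head (suc c) g = trans (cong (_+ g (suc c)) (∑<-head c g)) (ℕₚ.+-assoc (g 0) _ _)

∑<-reflect-tail : ∀ m t {c} (f g : ℕ → ℕ) → t + c ≡ suc m → (∀ i i' → i + i' ≡ m → f i ≡ g i') →
                  ∑< c (λ i → f (t + i)) ≡ ∑< c g
∑<-reflect-tail m t {c} f g t+c≡1+m f≡g =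
  trans (∑<-cong c (λ i i<c → f≡g (t + i) (c ∸ suc i) (indices i i<c))) (∑<-reverse c g)
  where
  indices : ∀ i → i < c → t + i + (c ∸ suc i) ≡ m
  indices i i<c = ℕₚ.suc-injective (trans (shuffle t i (c ∸ suc i)) (trans (cong (t +_) (ℕₚ.m∸n+n≡m i<c)) t+c≡1+m))
    where
    shuffle : ∀ t i x → suc (t + i + x) ≡ t + (x + suc i)
    shuffle = solve-∀

∑<-exchange : ∀ c {p} (f g : ℕ → ℕ) → p < c → (∀ t → t < c → t ≢ p → f t ≡ g t) → ∑< c f + g p ≡ ∑< c g + f p
∑<-exchange (suc c) {p} f g p<1+c f≡g with p ℕₚ.≟ c
... | yes refl = begin
  ∑< p f + f p + g p  ≡⟨ cong (λ x → x + f p + g p) (∑<-cong p (λ t t<p → f≡g t (ℕₚ.m<n⇒m<1+n t<p) (ℕₚ.<⇒≢ t<p))) ⟩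
  ∑< p g + f p + g p  ≡⟨ xy∙z≈xz∙y (∑< p g) (f p) (g p) ⟩
  ∑< p g + g p + f p  ∎
  where open ≡-Reasoning
... | no  p≢c  = begin
  ∑< c f + f c + g p  ≡⟨ xy∙z≈xz∙y (∑< c f) (f c) (g p) ⟩
  ∑< c f + g p + f c  ≡⟨ cong (_+ f c) (∑<-exchange c f g p<c (λ t t<c → f≡g t (ℕₚ.m<n⇒m<1+n t<c))) ⟩
  ∑< c g + f p + f c  ≡⟨ xy∙z≈xz∙y (∑< c g) (f p) (f c) ⟩
  ∑< c g + f c + f p  ≡⟨ cong (λ x → ∑< c g + x + f p) (f≡g c ℕₚ.≤-refl (λ c≡p → p≢c (sym c≡p))) ⟩
  ∑< c g + g c + f p  ∎
  where
  open ≡-Reasoning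
  p<c : p < c
  p<c = ℕₚ.≤∧≢⇒< (ℕₚ.≤-pred p<1+c) p≢c

∑<-indicator-≡ : ∀ n a → ∑< n (λ m → indicator (does (m ℕₚ.≟ a))) ≤ 1
∑<-indicator-≡ zero    a = z≤n
∑<-indicator-≡ (suc n) a with n ℕₚ.≟ a
... | yes refl rewrite dec-true (n ℕₚ.≟ n) refl =
  ℕₚ.≤-reflexive (cong (_+ 1) (∑<-zero n (λ m m<n → cong indicator (dec-false (m ℕₚ.≟ n) (ℕₚ.<⇒≢ m<n)))))
... | no  n≢a rewrite dec-false (n ℕₚ.≟ a) n≢a = subst (_≤ 1) (sym (ℕₚ.+-identityʳ _)) (∑<-indicator-≡ n a)

∑<-const-1 : ∀ n → ∑< n (λ _ → 1) ≡ n
∑<-const-1 zero    = refl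
∑<-const-1 (suc n) = trans (cong (_+ 1) (∑<-const-1 n)) (ℕₚ.+-comm n 1)

sumList-upTo : ∀ (f : ℕ → ℕ) n → sumList f (upTo n) ≡ ∑< n f
sumList-upTo f zero    = refl
sumList-upTo f (suc n) = begin
  sumList f (upTo (suc n))        ≡⟨ cong (sumList f) (sym (Listₚ.upTo-∷ʳ n)) ⟩
  sumList f (upTo n ++ [ n ])     ≡⟨ sumList-++ f (upTo n) [ n ] ⟩
  sumList f (upTo n) + (f n + 0)  ≡⟨ cong₂ _+_ (sumList-upTo f n) (ℕₚ.+-identityʳ (f n)) ⟩
  ∑< n f + f n                    ∎
  where open ≡-Reasoning

-- F l k ρ counts the arrangements of an l-letter totally ordered alphabet that have k descents
-- when preceded by a letter exceeding exactly ρ of the letters; a next letter of rank t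
-- contributes a descent iff t < ρ, which Fnext records by shifting k (F↓ l 0 = 0).
mutual
  F : ℕ → ℕ → ℕ → ℕ
  F zero    zero    ρ = 1
  F zero    (suc k) ρ = 0
  F (suc l) k       ρ = ∑< (suc l) (λ t → Fnext l k (does (t <? ρ)) t)

  F↓ : ℕ → ℕ → ℕ → ℕ
  F↓ l zero    t = 0
  F↓ l (suc k) t = F l k t

  Fnext : ℕ → ℕ → Bool → ℕ → ℕ
  Fnext l k true  t = F↓ l k t
  Fnext l k false t = F l k t

F-vanishes : ∀ {l k} t → l < k → F l k t ≡ 0
F-vanishes {zero}  {suc k} t _       = refl
F-vanishes {suc l} {suc k} ρ (s≤s l<k) = ∑<-zero (suc l) (λ t _ → Fnext-vanishes (does (t <? ρ)) t)
  where
  Fnext-vanishes : ∀ c t → Fnext l (suc k) c t ≡ 0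
  Fnext-vanishes true  t = F-vanishes t l<k
  Fnext-vanishes false t = F-vanishes t (ℕₚ.m<n⇒m<1+n l<k)

0<F-0-0 : ∀ l → 0 < F l 0 0
0<F-0-0 zero    = s≤s z≤n
0<F-0-0 (suc l) = ℕₚ.≤-trans (0<F-0-0 l) (term≤∑< (suc l) (λ t → F l 0 t) (s≤s z≤n))

descent-reflect : ∀ {l} i {i'} ρ {ρ'} → i + i' ≡ l → ρ + ρ' ≡ suc l → does (i' <? ρ') ≡ not (does (i <? ρ))
descent-reflect {l} i {i'} ρ {ρ'} i+i'≡l ρ+ρ'≡1+l with i <? ρ
... | yes i<ρ rewrite dec-true (i <? ρ) i<ρ = dec-false (i' <? ρ') (ℕₚ.≤⇒≯ (ℕₚ.+-cancelˡ-≤ (suc i) ρ' i' (begin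
  suc i + ρ'  ≤⟨ ℕₚ.+-monoˡ-≤ ρ' i<ρ ⟩
  ρ + ρ'      ≡⟨ trans ρ+ρ'≡1+l (cong suc (sym i+i'≡l)) ⟩
  suc i + i'  ∎)))
  where open ℕₚ.≤-Reasoning
... | no  i≮ρ rewrite dec-false (i <? ρ) i≮ρ = dec-true (i' <? ρ') (ℕₚ.+-cancelˡ-≤ ρ (suc i') ρ' (begin
  ρ + suc i'  ≤⟨ ℕₚ.+-monoˡ-≤ (suc i') (ℕₚ.≮⇒≥ i≮ρ) ⟩
  i + suc i'  ≡⟨ trans (ℕₚ.+-suc i i') (trans (cong suc i+i'≡l) (sym ρ+ρ'≡1+l)) ⟩
  ρ + ρ'      ∎))
  where open ℕₚ.≤-Reasoning

-- Reversing the order of the alphabet exchanges ascents and descents.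
F-reflect : ∀ {l} k k' t t' → k + k' ≡ l → t + t' ≡ l → F l k t ≡ F l k' t'
F-reflect {zero}  zero zero _ _ refl _ = refl
F-reflect {suc l} k k' ρ ρ' k+k'≡1+l ρ+ρ'≡1+l =
  trans (∑<-cong (suc l) termwise) (∑<-reverse (suc l) (λ t → Fnext l k' (does (t <? ρ')) t))
  where
  termwise : ∀ i → i < suc l → Fnext l k (does (i <? ρ)) i ≡ Fnext l k' (does ((l ∸ i) <? ρ')) (l ∸ i)
  termwise i i<1+l = trans (Fnext-reflect k k' k+k'≡1+l (does (i <? ρ)))
                            (cong (λ c → Fnext l k' c (l ∸ i)) (sym (descent-reflect i ρ i+l∸i≡l ρ+ρ'≡1+l)))
    where
    i+l∸i≡l : i + (l ∸ i) ≡ l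
    i+l∸i≡l = ℕₚ.m+[n∸m]≡n (ℕₚ.≤-pred i<1+l)
    Fnext-reflect : ∀ k k' → k + k' ≡ suc l → ∀ c → Fnext l k c i ≡ Fnext l k' (not c) (l ∸ i)
    Fnext-reflect zero      k'        k+k'≡1+l true  = sym (F-vanishes (l ∸ i) (subst (l <_) (sym k+k'≡1+l) ℕₚ.≤-refl))
    Fnext-reflect (suc k)   k'        k+k'≡1+l true  = F-reflect k k' i (l ∸ i) (ℕₚ.suc-injective k+k'≡1+l) i+l∸i≡l
    Fnext-reflect k         zero      k+k'≡1+l false = F-vanishes i (subst (l <_) (sym (trans (sym (ℕₚ.+-identityʳ k)) k+k'≡1+l)) ℕₚ.≤-refl)
    Fnext-reflect k         (suc k')  k+k'≡1+l false = F-reflect k k' i (l ∸ i) (ℕₚ.suc-injective (trans (sym (ℕₚ.+-suc k k')) k+k'≡1+l)) i+l∸i≡l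

F-reflect↓ : ∀ {m} k k' t t' → k + k' ≡ suc m → t + t' ≡ m → F m k t ≡ F↓ m k' t'
F-reflect↓ {m} k zero     t t' k+k'≡1+m _ = F-vanishes _ (subst (m <_) (sym (trans (sym (ℕₚ.+-identityʳ k)) k+k'≡1+m)) ℕₚ.≤-refl)
F-reflect↓ {m} k (suc k') t t' k+k'≡1+m t+t'≡m = F-reflect k k' t t' (ℕₚ.suc-injective (trans (sym (ℕₚ.+-suc k k')) k+k'≡1+m)) t+t'≡m

-- Raising ρ by one turns exactly the term of rank ρ from a non-descent into a descent.
F-exchange : ∀ l k {ρ} → ρ ≤ l → F (suc l) k ρ + F↓ l k ρ ≡ F (suc l) k (suc ρ) + F l k ρ
F-exchange l k {ρ} ρ≤l = begin
  F (suc l) k ρ + F↓ l k ρ             ≡⟨ cong (F (suc l) k ρ +_) (cong (λ c → Fnext l k c ρ) (sym (dec-true (ρ <? suc ρ) ℕₚ.≤-refl))) ⟩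
  F (suc l) k ρ + after ρ              ≡⟨ ∑<-exchange (suc l) before after (s≤s ρ≤l) agree ⟩
  F (suc l) k (suc ρ) + before ρ       ≡⟨ cong (F (suc l) k (suc ρ) +_) (cong (λ c → Fnext l k c ρ) (dec-false (ρ <? ρ) (ℕₚ.<-irrefl refl))) ⟩
  F (suc l) k (suc ρ) + F l k ρ        ∎
  where
  open ≡-Reasoning
  before after : ℕ → ℕ
  before t = Fnext l k (does (t <? ρ)) t
  after  t = Fnext l k (does (t <? suc ρ)) t
  agree : ∀ t → t < suc l → t ≢ ρ → before t ≡ after t
  agree t _ t≢ρ with ℕₚ.<-cmp t ρ
  ... | tri< t<ρ _ _ rewrite dec-true (t <? ρ) t<ρ | dec-true (t <? suc ρ) (ℕₚ.m<n⇒m<1+n t<ρ) = refl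
  ... | tri≈ _ t≡ρ _ = ⊥-elim (t≢ρ t≡ρ)
  ... | tri> _ _ ρ<t rewrite dec-false (t <? ρ) (ℕₚ.<⇒≯ ρ<t) | dec-false (t <? suc ρ) (ℕₚ.<⇒≱ ρ<t ∘ ℕₚ.≤-pred) = refl

F-row-link : ∀ l k → F (suc l) k 0 ≡ F (suc l) (suc k) (suc l)
F-row-link l k = ∑<-cong (suc l) (λ t t<1+l → cong (λ c → Fnext l (suc k) c t) (sym (dec-true (t <? suc l) t<1+l)))

F-split : ∀ m k j {c} → j + c ≡ suc m → F (suc m) k j ≡ ∑< j (F↓ m k) + ∑< c (λ i → F m k (j + i))
F-split m k j {c} j+c≡1+m = begin
  ∑< (suc m) term                               ≡⟨ cong (λ x → ∑< x term) (sym j+c≡1+m) ⟩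
  ∑< (j + c) term                               ≡⟨ ∑<-+ j c term ⟩
  ∑< j term + ∑< c (λ i → term (j + i))         ≡⟨ cong₂ _+_ (∑<-cong j below) (∑<-cong c above) ⟩
  ∑< j (F↓ m k) + ∑< c (λ i → F m k (j + i))    ∎
  where
  open ≡-Reasoning
  term : ℕ → ℕ
  term t = Fnext m k (does (t <? j)) t
  below : ∀ t → t < j → term t ≡ F↓ m k t
  below t t<j rewrite dec-true (t <? j) t<j = refl
  above : ∀ i → i < c → term (j + i) ≡ F m k (j + i)
  above i _ rewrite dec-false ((j + i) <? j) (ℕₚ.≤⇒≯ (ℕₚ.m≤m+n j i)) = refl

multiplicity : ℤ → List ℤ → ℕ
multiplicity x = count (λ u → does (u ℤ.≟ x))

maximum-exists : ∀ (R : ℤ → Bool) xs {c} → count R xs ≡ suc c →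
                 ∃[ M ] (M ∈ xs × R M ≡ true × (∀ u → u ∈ xs → R u ≡ true → u ℤ.≤ M))
maximum-exists R (x ∷ xs) #R with R x in Rx
... | false with M , M∈ , RM , M-max ← maximum-exists R xs #R =
  M , there M∈ , RM , λ { u (here refl) Ru → ⊥-elim (false≢true (trans (sym Rx) Ru)) ; u (there u∈) Ru → M-max u u∈ Ru }
... | true with count R xs in #R-xs
...   | zero = x , here refl , Rx , λ { u (here refl) _ → ℤₚ.≤-refl
                                     ; u (there u∈) Ru → ⊥-elim (false≢true (trans (sym (count≡0⇒ R xs #R-xs u u∈)) Ru)) }
...   | suc _ with M , M∈ , RM , M-max ← maximum-exists R xs #R-xs with x ℤ.≤? M
...     | yes x≤M = M , there M∈ , RM , λ { u (here refl) _ → x≤M ; u (there u∈) Ru → M-max u u∈ Ru }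
...     | no  x≰M = x , here refl , Rx , λ { u (here refl) _ → ℤₚ.≤-refl
                                            ; u (there u∈) Ru → ℤₚ.≤-trans (M-max u u∈ Ru) (ℤₚ.<⇒≤ (ℤₚ.≰⇒> x≰M)) }

module RankSum (xs : List ℤ) (distinct : ∀ x → multiplicity x xs ≤ 1) where

  rank : (ℤ → Bool) → ℤ → ℕ
  rank R v = count (λ u → R u ∧ does (u ℤ.<? v)) xs

  multiplicity-∈ : ∀ {x} → x ∈ xs → multiplicity x xs ≡ 1
  multiplicity-∈ {x} x∈ = ℕₚ.≤-antisym (distinct x)
    (subst (_< multiplicity x xs) (count-zero (λ _ → false) xs (λ _ → refl))
      (count-mono-<∈ (λ _ → false) (λ u → does (u ℤ.≟ x)) xs (λ _ _ ()) x x∈ refl (dec-true (x ℤ.≟ x) refl)))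

  module WithoutMaximum (R : ℤ → Bool) {M : ℤ} (M∈ : M ∈ xs) (RM : R M ≡ true)
                        (M-max : ∀ u → u ∈ xs → R u ≡ true → u ℤ.≤ M) where

    R⁻ : ℤ → Bool
    R⁻ u = R u ∧ not (does (u ℤ.≟ M))

    count-R : count R xs ≡ suc (count R⁻ xs)
    count-R = begin
      count R xs                                           ≡⟨ count-split R (λ u → does (u ℤ.≟ M)) xs ⟩
      count (λ u → R u ∧ does (u ℤ.≟ M)) xs + count R⁻ xs  ≡⟨ cong (_+ count R⁻ xs) (count-cong xs R-at-M) ⟩
      multiplicity M xs + count R⁻ xs                      ≡⟨ cong (_+ count R⁻ xs) (multiplicity-∈ M∈) ⟩
      suc (count R⁻ xs)                                    ∎
      where
      open ≡-Reasoning
      R-at-M : ∀ u → (R u ∧ does (u ℤ.≟ M)) ≡ does (u ℤ.≟ M)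
      R-at-M u with u ℤ.≟ M
      ... | yes refl = cong (_∧ true) RM
      ... | no  _    = Boolₚ.∧-zeroʳ (R u)

    rank-M : rank R M ≡ count R⁻ xs
    rank-M = count-cong∈ xs below-M
      where
      below-M : ∀ u → u ∈ xs → (R u ∧ does (u ℤ.<? M)) ≡ R⁻ u
      below-M u u∈ with R u in Ru
      ... | false = refl
      ... | true with u ℤ.≟ M
      ...   | yes refl = dec-false (u ℤ.<? u) (ℤₚ.<-irrefl refl)
      ...   | no  u≢M  = dec-true (u ℤ.<? M) (ℤₚ.≤∧≢⇒< (M-max u u∈ Ru) u≢M)

    rank-R⁻ : ∀ v → v ∈ xs → R v ≡ true → rank R v ≡ rank R⁻ v
    rank-R⁻ v v∈ Rv = count-cong xs M-not-below
      where
      M-not-below : ∀ u → (R u ∧ does (u ℤ.<? v)) ≡ (R⁻ u ∧ does (u ℤ.<? v))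
      M-not-below u with R u | u ℤ.≟ M
      ... | false | _        = refl
      ... | true  | no  _    = refl
      ... | true  | yes refl = dec-false (u ℤ.<? v) (ℤₚ.≤⇒≯ (M-max v v∈ Rv))

    term-split : ∀ (K : ℕ → ℕ) v → v ∈ xs →
      (if R v then K (rank R v) else 0) ≡ (if R⁻ v then K (rank R⁻ v) else 0) + indicator (does (v ℤ.≟ M)) * K (count R⁻ xs)
    term-split K v v∈ with v ℤ.≟ M
    ... | yes refl rewrite RM = trans (cong K rank-M) (sym (ℕₚ.+-identityʳ _))
    ... | no  _ with R v in Rv
    ...   | false = refl
    ...   | true  = trans (cong K (rank-R⁻ v v∈ Rv)) (sym (ℕₚ.+-identityʳ _))

  -- The ranks of the c elements of R are 0, …, c - 1: peel off the largest one.
  sum-over-ranks : ∀ c (R : ℤ → Bool) → count R xs ≡ c → (K : ℕ → ℕ) →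
                   sumList (λ v → if R v then K (rank R v) else 0) xs ≡ ∑< c K
  sum-over-ranks zero    R #R K = sumList-zero∈ _ xs (λ v v∈ → cong (λ b → if b then K (rank R v) else 0) (count≡0⇒ R xs #R v v∈))
  sum-over-ranks (suc c) R #R K with M , M∈ , RM , M-max ← maximum-exists R xs #R = begin
    sumList (λ v → if R v then K (rank R v) else 0) xs
      ≡⟨ sumList-cong∈ xs (term-split K) ⟩
    sumList (λ v → (if R⁻ v then K (rank R⁻ v) else 0) + indicator (does (v ℤ.≟ M)) * K (count R⁻ xs)) xs
      ≡⟨ sumList-+ _ _ xs ⟩
    sumList (λ v → if R⁻ v then K (rank R⁻ v) else 0) xs + sumList (λ v → indicator (does (v ℤ.≟ M)) * K (count R⁻ xs)) xs
      ≡⟨ cong₂ _+_ (sum-over-ranks c R⁻ #R⁻ K) (trans (sumList-*ʳ _ _ xs) (cong₂ _*_ (multiplicity-∈ M∈) (cong K #R⁻))) ⟩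
    ∑< c K + 1 * K c
      ≡⟨ cong (_+_ (∑< c K)) (ℕₚ.*-identityˡ (K c)) ⟩
    ∑< (suc c) K ∎
    where
    open ≡-Reasoning
    open WithoutMaximum R M∈ RM M-max
    #R⁻ : count R⁻ xs ≡ c
    #R⁻ = ℕₚ.suc-injective (trans (sym count-R) #R)

does-all : ∀ {P : A → Set} (P? : ∀ x → Dec (P x)) xs → does (All.all? P? xs) ≡ all (does ∘ P?) xs
does-all P? []       = refl
does-all P? (x ∷ xs) = cong (does (P? x) ∧_) (does-all P? xs)

length-filter-filter : ∀ {P Q : A → Set} (P? : ∀ x → Dec (P x)) (Q? : ∀ x → Dec (Q x)) xs →
                       length (filter P? (filter Q? xs)) ≡ count (λ x → does (Q? x) ∧ does (P? x)) xs
length-filter-filter P? Q? []       = refl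
length-filter-filter P? Q? (x ∷ xs) with does (Q? x)
... | false = length-filter-filter P? Q? xs
... | true with does (P? x)
...   | false = length-filter-filter P? Q? xs
...   | true  = cong suc (length-filter-filter P? Q? xs)

distinctᵇ : List ℕ → Bool
distinctᵇ []       = true
distinctᵇ (x ∷ xs) = all (λ y → not (x ≡ᵇ y)) xs ∧ distinctᵇ xs

does-unique : ∀ xs → does (unique? xs) ≡ distinctᵇ xs
does-unique []       = refl
does-unique (x ∷ xs) = cong₂ _∧_ (does-all _ xs) (does-unique xs)

_∈ᵇ_ : ℕ → List ℕ → Bool
y ∈ᵇ S = any (_≡ᵇ y) S

avoids : List ℕ → List ℕ → Bool
avoids S = all (λ y → not (y ∈ᵇ S))

avoids-[] : ∀ ys → avoids [] ys ≡ true
avoids-[] []       = refl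
avoids-[] (y ∷ ys) = avoids-[] ys

avoids-∷ : ∀ x S ys → avoids (x ∷ S) ys ≡ all (λ y → not (x ≡ᵇ y)) ys ∧ avoids S ys
avoids-∷ x S []       = refl
avoids-∷ x S (y ∷ ys) with x ≡ᵇ y
... | true  = refl
... | false rewrite avoids-∷ x S ys =
  prove 3 (P ⊕ (Q ⊕ R)) (Q ⊕ (P ⊕ R)) (not (y ∈ᵇ S) ∷ all (λ y → not (x ≡ᵇ y)) ys ∷ avoids S ys ∷ [])
  where
  P Q R : Expr 3
  P = var (# 0)
  Q = var (# 1)
  R = var (# 2)

±[1+_] : ℕ → List ℤ
±[1+ m ] = +[1+ m ] ∷ -[1+ m ] ∷ []

module SignedWords (n j : ℕ) where

  letters : List ℤ
  letters = signedValues n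

  signOK : ℤ → Bool
  signOK x = does (does (x ℤ.<? +0) Boolₚ.≟ does (∣ x ∣ ≤? j))

  -- S holds the absolute values of the letters placed so far.
  usable : List ℕ → ℤ → Bool
  usable S x = signOK x ∧ not (∣ x ∣ ∈ᵇ S)

  Valid : List ℕ → ℤ → ℕ → List ℤ → Bool
  Valid S a k w = distinctᵇ (map ∣_∣ w) ∧ (avoids S (map ∣_∣ w) ∧ (all signOK w ∧ (desFrom a w ≡ᵇ k)))

  countValid : List ℕ → ℤ → ℕ → ℕ → ℕ
  countValid S a k l = count (Valid S a k) (words letters l)

  countNext : List ℕ → ℤ → Bool → ℕ → ℕ → ℕ
  countNext S v false k       l = countValid (∣ v ∣ ∷ S) v k l
  countNext S v true  zero    l = 0
  countNext S v true  (suc k) l = countValid (∣ v ∣ ∷ S) v k l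

  size : List ℕ → ℕ
  size S = count (usable S) letters

  rank : List ℕ → ℤ → ℕ
  rank S a = count (λ u → usable S u ∧ does (u ℤ.<? a)) letters

  letters-distinct : ∀ x → multiplicity x letters ≤ 1
  letters-distinct x = subst (_≤ 1) (sym (sumList-concatMap _ ±[1+_] (upTo n))) (per-letter x)
    where
    per-letter : ∀ x → sumList (λ m → multiplicity x ±[1+ m ]) (upTo n) ≤ 1
    per-letter +0  = subst (_≤ 1) (sym (sumList-zero∈ _ (upTo n) (λ _ _ → refl))) z≤n
    per-letter +[1+ a ] = subst (_≤ 1) (sym (trans (sumList-cong (upTo n) (λ m → ℕₚ.+-identityʳ _)) (sumList-upTo _ n))) (∑<-indicator-≡ n a)
    per-letter -[1+ a ]  = subst (_≤ 1) (sym (trans (sumList-cong (upTo n) (λ m → ℕₚ.+-identityʳ _)) (sumList-upTo _ n))) (∑<-indicator-≡ n a)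

  open RankSum letters letters-distinct using (multiplicity-∈; sum-over-ranks)

  size-[] : size [] ≡ n
  size-[] = begin
    count (usable []) letters                                        ≡⟨ sumList-concatMap _ ±[1+_] (upTo n) ⟩
    sumList (λ m → count (usable []) ±[1+ m ]) (upTo n) ≡⟨ sumList-cong (upTo n) one-sign-fits ⟩
    sumList (λ _ → 1) (upTo n)                                       ≡⟨ sumList-upTo _ n ⟩
    ∑< n (λ _ → 1)                                                   ≡⟨ ∑<-const-1 n ⟩
    n                                                                ∎
    where
    open ≡-Reasoning
    one-sign-fits : ∀ m → count (usable []) ±[1+ m ] ≡ 1
    one-sign-fits m with does (suc m ≤? j)
    ... | true  = refl
    ... | false = refl

  rank-[] : j ≤ n → rank [] +0 ≡ j
  rank-[] j≤n = begin
    rank [] +0                                        ≡⟨ sumList-concatMap _ ±[1+_] (upTo n) ⟩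
    sumList (λ m → count (λ u → usable [] u ∧ does (u ℤ.<? +0)) ±[1+ m ]) (upTo n) ≡⟨ sumList-cong (upTo n) negative-fits ⟩
    sumList (λ m → indicator (does (suc m ≤? j))) (upTo n) ≡⟨ sumList-upTo _ n ⟩
    ∑< n (λ m → indicator (does (suc m ≤? j)))            ≡⟨ cong (λ x → ∑< x _) (sym (ℕₚ.m+[n∸m]≡n j≤n)) ⟩
    ∑< (j + (n ∸ j)) (λ m → indicator (does (suc m ≤? j))) ≡⟨ ∑<-+ j (n ∸ j) _ ⟩
    ∑< j _ + ∑< (n ∸ j) _                                ≡⟨ cong₂ _+_ (∑<-cong j below) (∑<-zero (n ∸ j) above) ⟩
    ∑< j (λ _ → 1) + 0                                  ≡⟨ trans (ℕₚ.+-identityʳ _) (∑<-const-1 j) ⟩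
    j                                                    ∎
    where
    open ≡-Reasoning
    negative-fits : ∀ m → count (λ u → usable [] u ∧ does (u ℤ.<? +0)) ±[1+ m ] ≡ indicator (does (suc m ≤? j))
    negative-fits m with does (suc m ≤? j)
    ... | true  = refl
    ... | false = refl
    below : ∀ m → m < j → indicator (does (suc m ≤? j)) ≡ 1
    below m m<j rewrite dec-true (suc m ≤? j) m<j = refl
    above : ∀ i → i < n ∸ j → indicator (does (suc (j + i) ≤? j)) ≡ 0
    above i _ rewrite dec-false (suc (j + i) ≤? j) (ℕₚ.<⇒≱ (s≤s (ℕₚ.m≤m+n j i))) = refl

  signOK-abs-injective : ∀ {x y} → signOK x ≡ true → signOK y ≡ true → ∣ x ∣ ≡ ∣ y ∣ → x ≡ y
  signOK-abs-injective {ℤ.+ a} {ℤ.+ b} _   _   |x|≡|y| = cong ℤ.+_ |x|≡|y|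
  signOK-abs-injective { -[1+ a ]} { -[1+ b ]} _   _   |x|≡|y| = cong -[1+_] (ℕₚ.suc-injective |x|≡|y|)
  signOK-abs-injective {ℤ.+ .(suc b)} { -[1+ b ]} ok₁ ok₂ refl =
    ⊥-elim (false≢true (trans (does-true⇒ (false Boolₚ.≟ does (suc b ≤? j)) ok₁) (sym (does-true⇒ (true Boolₚ.≟ does (suc b ≤? j)) ok₂))))
  signOK-abs-injective { -[1+ a ]} {ℤ.+ .(suc a)} ok₁ ok₂ refl =
    ⊥-elim (false≢true (trans (does-true⇒ (false Boolₚ.≟ does (suc a ≤? j)) ok₂) (sym (does-true⇒ (true Boolₚ.≟ does (suc a ≤? j)) ok₁))))

  usable-∷ : ∀ v S u → usable (∣ v ∣ ∷ S) u ≡ usable S u ∧ not (∣ v ∣ ≡ᵇ ∣ u ∣)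
  usable-∷ v S u with ∣ v ∣ ≡ᵇ ∣ u ∣
  ... | true  = trans (Boolₚ.∧-zeroʳ (signOK u)) (sym (Boolₚ.∧-zeroʳ (usable S u)))
  ... | false = sym (Boolₚ.∧-identityʳ (usable S u))

  usable-same-abs : ∀ S {v} → usable S v ≡ true → ∀ u → (usable S u ∧ (∣ v ∣ ≡ᵇ ∣ u ∣)) ≡ does (u ℤ.≟ v)
  usable-same-abs S {v} v-ok u with usable S u in u-ok | ∣ v ∣ ℕₚ.≟ ∣ u ∣
  ... | false | _ = sym (dec-false (u ℤ.≟ v) (λ { refl → false≢true (trans (sym u-ok) v-ok) }))
  ... | true  | yes |v|≡|u| rewrite dec-true (∣ v ∣ ℕₚ.≟ ∣ u ∣) |v|≡|u| =
    sym (dec-true (u ℤ.≟ v) (signOK-abs-injective (∧-true⇒left u-ok) (∧-true⇒left v-ok) (sym |v|≡|u|)))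
  ... | true  | no  |v|≢|u| rewrite dec-false (∣ v ∣ ℕₚ.≟ ∣ u ∣) |v|≢|u| =
    sym (dec-false (u ℤ.≟ v) (λ { refl → |v|≢|u| refl }))

  size-∷ : ∀ S {v l} → v ∈ letters → usable S v ≡ true → size S ≡ suc l → size (∣ v ∣ ∷ S) ≡ l
  size-∷ S {v} {l} v∈ v-ok size≡1+l = ℕₚ.suc-injective (begin
    suc (size (∣ v ∣ ∷ S))                                                   ≡⟨ cong suc (count-cong letters (usable-∷ v S)) ⟩
    suc (count others letters)                                               ≡⟨ cong (_+ count others letters) (sym (multiplicity-∈ v∈)) ⟩
    multiplicity v letters + count others letters                            ≡⟨ cong (_+ count others letters) (sym (count-cong letters (usable-same-abs S v-ok))) ⟩
    count (λ u → usable S u ∧ (∣ v ∣ ≡ᵇ ∣ u ∣)) letters + count others letters ≡⟨ count-split (usable S) (λ u → ∣ v ∣ ≡ᵇ ∣ u ∣) letters ⟨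
    size S                                                                   ≡⟨ size≡1+l ⟩
    suc l                                                                    ∎)
    where
    open ≡-Reasoning
    others : ℤ → Bool
    others u = usable S u ∧ not (∣ v ∣ ≡ᵇ ∣ u ∣)

  rank-∷ : ∀ S {v} → usable S v ≡ true → rank (∣ v ∣ ∷ S) v ≡ rank S v
  rank-∷ S {v} v-ok = count-cong letters same-below
    where
    same-below : ∀ u → (usable (∣ v ∣ ∷ S) u ∧ does (u ℤ.<? v)) ≡ (usable S u ∧ does (u ℤ.<? v))
    same-below u rewrite usable-∷ v S u with usable S u in u-ok | ∣ v ∣ ℕₚ.≟ ∣ u ∣
    ... | false | _ = refl
    ... | true  | no  |v|≢|u| rewrite dec-false (∣ v ∣ ℕₚ.≟ ∣ u ∣) |v|≢|u| = refl
    ... | true  | yes |v|≡|u| with refl ← signOK-abs-injective {u} {v} (∧-true⇒left u-ok) (∧-true⇒left v-ok) (sym |v|≡|u|)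
      rewrite dec-true (∣ v ∣ ℕₚ.≟ ∣ v ∣) refl | dec-false (v ℤ.<? v) (ℤₚ.<-irrefl refl) = refl

  descent⇔rank< : ∀ S {v} a → v ∈ letters → usable S v ≡ true → does (v ℤ.<? a) ≡ does (rank S v <? rank S a)
  descent⇔rank< S {v} a v∈ v-ok with v ℤ.<? a
  ... | yes v<a = sym (dec-true (rank S v <? rank S a)
          (count-mono-<∈ (λ u → usable S u ∧ does (u ℤ.<? v)) (λ u → usable S u ∧ does (u ℤ.<? a)) letters
             below-v⇒below-a v v∈ (cong₂ _∧_ v-ok (dec-false (v ℤ.<? v) (ℤₚ.<-irrefl refl))) (cong₂ _∧_ v-ok (dec-true (v ℤ.<? a) v<a))))
    where
    below-v⇒below-a : ∀ u → u ∈ letters → (usable S u ∧ does (u ℤ.<? v)) ≡ true → (usable S u ∧ does (u ℤ.<? a)) ≡ true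
    below-v⇒below-a u _ below-v = cong₂ _∧_ (∧-true⇒left below-v)
      (dec-true (u ℤ.<? a) (ℤₚ.<-trans (does-true⇒ (u ℤ.<? v) (∧-true⇒right below-v)) v<a))
  ... | no  v≮a = sym (dec-false (rank S v <? rank S a) (ℕₚ.≤⇒≯
          (count-mono∈ (λ u → usable S u ∧ does (u ℤ.<? a)) (λ u → usable S u ∧ does (u ℤ.<? v)) letters below-a⇒below-v)))
    where
    below-a⇒below-v : ∀ u → u ∈ letters → (usable S u ∧ does (u ℤ.<? a)) ≡ true → (usable S u ∧ does (u ℤ.<? v)) ≡ true
    below-a⇒below-v u _ below-a = cong₂ _∧_ (∧-true⇒left below-a)
      (dec-true (u ℤ.<? v) (ℤₚ.<-≤-trans (does-true⇒ (u ℤ.<? a) (∧-true⇒right below-a)) (ℤₚ.≮⇒≥ v≮a)))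

  -- Valid (∣ v ∣ ∷ S) v k, with the target k lowered by one when c records a descent at v.
  ValidAfter : List ℕ → ℤ → Bool → ℕ → List ℤ → Bool
  ValidAfter S v c k w = distinctᵇ (map ∣_∣ w) ∧ (avoids (∣ v ∣ ∷ S) (map ∣_∣ w) ∧ (all signOK w ∧ (indicator c + desFrom v w ≡ᵇ k)))

  Valid-∷ : ∀ S a k v w → Valid S a k (v ∷ w) ≡ usable S v ∧ ValidAfter S v (does (v ℤ.<? a)) k w
  Valid-∷ S a k v w rewrite avoids-∷ ∣ v ∣ S (map ∣_∣ w) =
    prove 7 ((v-fresh ⊕ w-distinct) ⊕ ((v-unused ⊕ w-unused) ⊕ ((v-sign ⊕ w-sign) ⊕ descents)))
            ((v-sign ⊕ v-unused) ⊕ (w-distinct ⊕ ((v-fresh ⊕ w-unused) ⊕ (w-sign ⊕ descents))))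
      (all (λ y → not (∣ v ∣ ≡ᵇ y)) (map ∣_∣ w) ∷ distinctᵇ (map ∣_∣ w) ∷ not (∣ v ∣ ∈ᵇ S) ∷ avoids S (map ∣_∣ w)
        ∷ signOK v ∷ all signOK w ∷ (indicator (does (v ℤ.<? a)) + desFrom v w ≡ᵇ k) ∷ [])
    where
    v-fresh w-distinct v-unused w-unused v-sign w-sign descents : Expr 7
    v-fresh    = var (# 0)
    w-distinct = var (# 1)
    v-unused   = var (# 2)
    w-unused   = var (# 3)
    v-sign     = var (# 4)
    w-sign     = var (# 5)
    descents   = var (# 6)

  count-ValidAfter : ∀ S v c k l → count (ValidAfter S v c k) (words letters l) ≡ countNext S v c k l
  count-ValidAfter S v false k       l = refl
  count-ValidAfter S v true  (suc k) l = refl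
  count-ValidAfter S v true  zero    l = count-zero _ (words letters l) λ w →
    trans (cong (λ t → distinctᵇ (map ∣_∣ w) ∧ (avoids (∣ v ∣ ∷ S) (map ∣_∣ w) ∧ t)) (Boolₚ.∧-zeroʳ (all signOK w)))
          (trans (cong (distinctᵇ (map ∣_∣ w) ∧_) (Boolₚ.∧-zeroʳ _)) (Boolₚ.∧-zeroʳ _))

  count-by-first-letter : ∀ S a k l →
    countValid S a k (suc l) ≡ sumList (λ v → if usable S v then countNext S v (does (v ℤ.<? a)) k l else 0) letters
  count-by-first-letter S a k l =
    trans (sumList-concatMap _ (λ v → map (v ∷_) (words letters l)) letters) (sumList-cong letters first-letter)
    where
    open ≡-Reasoning
    first-letter : ∀ v → count (Valid S a k) (map (v ∷_) (words letters l)) ≡ (if usable S v then countNext S v (does (v ℤ.<? a)) k l else 0)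
    first-letter v = begin
      count (Valid S a k) (map (v ∷_) (words letters l))
        ≡⟨ sumList-map _ (v ∷_) (words letters l) ⟩
      count (λ w → Valid S a k (v ∷ w)) (words letters l)
        ≡⟨ count-cong (words letters l) (Valid-∷ S a k v) ⟩
      count (λ w → usable S v ∧ ValidAfter S v (does (v ℤ.<? a)) k w) (words letters l)
        ≡⟨ count-const-∧ (usable S v) _ (words letters l) ⟩
      (if usable S v then count (ValidAfter S v (does (v ℤ.<? a)) k) (words letters l) else 0)
        ≡⟨ cong (λ x → if usable S v then x else 0) (count-ValidAfter S v (does (v ℤ.<? a)) k l) ⟩
      (if usable S v then countNext S v (does (v ℤ.<? a)) k l else 0) ∎

  countValid≡F : ∀ l S a k → size S ≡ l → countValid S a k l ≡ F l k (rank S a)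
  countValid≡F zero    S a zero    _ = refl
  countValid≡F zero    S a (suc k) _ = refl
  countValid≡F (suc l) S a k size≡1+l = begin
    countValid S a k (suc l)
      ≡⟨ count-by-first-letter S a k l ⟩
    sumList (λ v → if usable S v then countNext S v (does (v ℤ.<? a)) k l else 0) letters
      ≡⟨ sumList-cong∈ letters by-rank ⟩
    sumList (λ v → if usable S v then Fnext l k (does (rank S v <? rank S a)) (rank S v) else 0) letters
      ≡⟨ sum-over-ranks (suc l) (usable S) size≡1+l (λ t → Fnext l k (does (t <? rank S a)) t) ⟩
    F (suc l) k (rank S a) ∎
    where
    open ≡-Reasoning
    by-rank : ∀ v → v ∈ letters →
              (if usable S v then countNext S v (does (v ℤ.<? a)) k l else 0) ≡
              (if usable S v then Fnext l k (does (rank S v <? rank S a)) (rank S v) else 0)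
    by-rank v v∈ with usable S v in v-ok
    ... | false = refl
    ... | true  = trans (countNext≡Fnext (does (v ℤ.<? a)) k) (cong (λ c → Fnext l k c (rank S v)) (descent⇔rank< S a v∈ v-ok))
      where
      countNext≡Fnext : ∀ c k → countNext S v c k l ≡ Fnext l k c (rank S v)
      countNext≡Fnext false k       = trans (countValid≡F l (∣ v ∣ ∷ S) v k (size-∷ S v∈ v-ok size≡1+l)) (cong (F l k) (rank-∷ S v-ok))
      countNext≡Fnext true  zero    = refl
      countNext≡Fnext true  (suc k) = trans (countValid≡F l (∣ v ∣ ∷ S) v k (size-∷ S v∈ v-ok size≡1+l)) (cong (F l k) (rank-∷ S v-ok))

  Valid-[]-from-filters : ∀ {P : ℤ → Set} (P? : ∀ x → Dec (P x)) → (∀ x → does (P? x) ≡ signOK x) → ∀ k w →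
    (does (unique? (map ∣_∣ w)) ∧ (does (des w ℕₚ.≟ k) ∧ does (All.all? P? w))) ≡ Valid [] +0 k w
  Valid-[]-from-filters P? P?≡signOK k w
    rewrite does-unique (map ∣_∣ w) | does-all P? w | Listₚ.map-cong P?≡signOK w | avoids-[] (map ∣_∣ w) =
    cong (distinctᵇ (map ∣_∣ w) ∧_) (Boolₚ.∧-comm (des w ≡ᵇ k) (all signOK w))

b≡F : ∀ n k j → j ≤ n → b n k j ≡ F n k j
b≡F n k j j≤n = begin
  b n k j                                          ≡⟨ length-filter-filter _ _ (words letters n) ⟩
  count _ (words letters n)                        ≡⟨ count-cong (words letters n) (Valid-[]-from-filters _ (λ _ → refl) k) ⟩
  countValid [] +0 k n                          ≡⟨ countValid≡F n [] +0 k size-[] ⟩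
  F n k (rank [] +0)                            ≡⟨ cong (F n k) (rank-[] j≤n) ⟩
  F n k j                                          ∎
  where
  open ≡-Reasoning
  open SignedWords n j

RowStepHyp : ℕ → ℕ → ℕ → Set
RowStepHyp n k j = (2 * k < n × 1 ≤ j × j ≤ n) ⊎ (2 * k ≡ n × n < 2 * j × j ≤ n)

RowStepTie : ℕ → ℕ → ℕ → Set
RowStepTie n k j = (k ≡ 0 × 2 ≤ j × j ≤ n) ⊎ (2 * k + 1 ≡ n × j ≡ 1)

RowStep : ℕ → Set
RowStep n = ∀ k j → RowStepHyp n k j → F n k j ≤ F n k (j ∸ 1) × (¬ RowStepTie n k j → F n k j < F n k (j ∸ 1))

RowStepHyp⇒≤ : ∀ {n k j} → RowStepHyp n k j → j ≤ n
RowStepHyp⇒≤ (inj₁ (_ , _ , j≤n)) = j≤n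
RowStepHyp⇒≤ (inj₂ (_ , _ , j≤n)) = j≤n

ColumnStepHyp : ℕ → ℕ → ℕ → Set
ColumnStepHyp m k t = (2 * k ≤ m) ⊎ (2 * k ≡ suc m × suc m ≤ 2 * t)

-- Part (b) with k - 1 expressed through F↓; for k = 0 strictness needs t = 0, as F m 0 t = 0 otherwise.
ColumnStep : ℕ → Set
ColumnStep m = ∀ k t → t ≤ m → ColumnStepHyp m k t →
  F↓ m k t ≤ F m k t × (¬ (2 * k ≡ m × t ≡ 0) → (k ≡ 0 → t ≡ 0) → F↓ m k t < F m k t)

2*-suc : ∀ k → 2 * suc k ≡ suc (suc (2 * k))
2*-suc = solve-∀

rowStep-suc : ∀ m → ColumnStep m → RowStep (suc m)
rowStep-suc m col k zero    (inj₁ (_ , () , _))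
rowStep-suc m col k zero    (inj₂ (_ , () , _))
rowStep-suc m col k (suc ρ) hyp = weak , strict
  where
  ρ≤m : ρ ≤ m
  ρ≤m = ℕₚ.≤-pred (RowStepHyp⇒≤ {k = k} hyp)
  column-hyp : RowStepHyp (suc m) k (suc ρ) → ColumnStepHyp m k ρ
  column-hyp (inj₁ (2k<1+m , _ , _))       = inj₁ (ℕₚ.≤-pred 2k<1+m)
  column-hyp (inj₂ (2k≡1+m , 1+m<2+2ρ , _)) =
    inj₂ (2k≡1+m , subst (_≤ 2 * ρ) 2k≡1+m (ℕₚ.*-monoʳ-≤ 2 (ℕₚ.≤-pred (ℕₚ.*-cancelˡ-< 2 k (suc ρ) (subst (_< 2 * suc ρ) (sym 2k≡1+m) 1+m<2+2ρ)))))
  exchange : F (suc m) k ρ + F↓ m k ρ ≡ F (suc m) k (suc ρ) + F m k ρ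
  exchange = F-exchange m k ρ≤m
  column : F↓ m k ρ ≤ F m k ρ × (¬ (2 * k ≡ m × ρ ≡ 0) → (k ≡ 0 → ρ ≡ 0) → F↓ m k ρ < F m k ρ)
  column = col k ρ ρ≤m (column-hyp hyp)
  weak : F (suc m) k (suc ρ) ≤ F (suc m) k ρ
  weak = ℕₚ.+-cancelʳ-≤ (F m k ρ) _ _ (subst (_≤ F (suc m) k ρ + F m k ρ) exchange (ℕₚ.+-monoʳ-≤ (F (suc m) k ρ) (proj₁ column)))
  strict : ¬ RowStepTie (suc m) k (suc ρ) → F (suc m) k (suc ρ) < F (suc m) k ρ
  strict ¬tie = ℕₚ.+-cancelʳ-< (F m k ρ) _ _ (subst (_< F (suc m) k ρ + F m k ρ) exchange
                  (ℕₚ.+-monoʳ-< (F (suc m) k ρ) (proj₂ column not-center k≡0⇒ρ≡0)))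
    where
    not-center : ¬ (2 * k ≡ m × ρ ≡ 0)
    not-center (2k≡m , refl) = ¬tie (inj₂ (trans (ℕₚ.+-comm (2 * k) 1) (cong suc 2k≡m) , refl))
    k≡0⇒ρ≡0 : k ≡ 0 → ρ ≡ 0
    k≡0⇒ρ≡0 k≡0 = ℕₚ.n≤0⇒n≡0 (ℕₚ.≮⇒≥ (λ 0<ρ → ¬tie (inj₁ (k≡0 , s≤s 0<ρ , s≤s ρ≤m))))

row-antitone : ∀ {m} → RowStep m → ∀ {k} → 2 * k < m → ∀ {a} b → a ≤ b → b ≤ m → F m k b ≤ F m k a
row-antitone row 2k<m zero    z≤n _ = ℕₚ.≤-refl
row-antitone row {k} 2k<m (suc b) a≤1+b 1+b≤m with ℕₚ.m≤n⇒m<n∨m≡n a≤1+b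
... | inj₂ refl       = ℕₚ.≤-refl
... | inj₁ (s≤s a≤b) =
  ℕₚ.≤-trans (proj₁ (row k (suc b) (inj₁ (2k<m , s≤s z≤n , 1+b≤m)))) (row-antitone row 2k<m b a≤b (ℕₚ.<⇒≤ 1+b≤m))

Fnext-mono : ∀ {m} → ColumnStep m → ∀ k t →
             (∀ i → i < suc m → i < t → ColumnStepHyp m k i) → (∀ i → i < suc m → t ≤ i → ColumnStepHyp m (suc k) i) →
             ∀ i → i < suc m → Fnext m k (does (i <? t)) i ≤ Fnext m (suc k) (does (i <? t)) i
Fnext-mono col k t below above i i<1+m with i <? t
... | yes i<t rewrite dec-true (i <? t) i<t = proj₁ (col k i (ℕₚ.≤-pred i<1+m) (below i i<1+m i<t))
... | no  i≮t rewrite dec-false (i <? t) i≮t = proj₁ (col (suc k) i (ℕₚ.≤-pred i<1+m) (above i i<1+m (ℕₚ.≮⇒≥ i≮t)))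

-- At the centre of an even level the two sums are compared block by block after reflecting the tail.
columnStep-center-low : ∀ {m k} → ColumnStep m → RowStep m → suc (2 * k) ≡ m → ∀ t d → t + (d + t) ≡ suc m →
  F (suc m) k t ≤ F (suc m) (suc k) t × (1 ≤ t → F (suc m) k t < F (suc m) (suc k) t)
columnStep-center-low {m} {k} col row 1+2k≡m t d t+d+t≡1+m =
  subst₂ _≤_ (sym F-k) (sym F-1+k) (ℕₚ.≤-trans (ℕₚ.+-mono-≤ Q≤P (ℕₚ.+-monoʳ-≤ X H≤P)) (ℕₚ.≤-reflexive swap)) ,
  λ 1≤t → subst₂ _<_ (sym F-k) (sym F-1+k) (ℕₚ.<-≤-trans (ℕₚ.+-mono-<-≤ (Q<P 1≤t) (ℕₚ.+-monoʳ-≤ X H≤P)) (ℕₚ.≤-reflexive swap))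
  where
  Q P X H : ℕ
  Q = ∑< t (F↓ m k)
  P = ∑< t (F m k)
  X = ∑< d (λ i → F m k (t + i))
  H = ∑< t (λ i → F m k (t + (d + i)))
  swap : P + (X + P) ≡ P + (P + X)
  swap = cong (P +_) (ℕₚ.+-comm X P)
  1+k+k≡m : suc k + k ≡ m
  1+k+k≡m = trans (cong suc (cong (k +_) (sym (ℕₚ.+-identityʳ k)))) 1+2k≡m
  F-k : F (suc m) k t ≡ Q + (X + H)
  F-k = trans (F-split m k t t+d+t≡1+m) (cong (Q +_) (∑<-+ d t (λ i → F m k (t + i))))
  F-1+k : F (suc m) (suc k) t ≡ P + (P + X)
  F-1+k = trans (F-split m (suc k) t t+d+t≡1+m)
            (cong (P +_) (trans (∑<-reflect-tail m t (F m (suc k)) (F m k) t+d+t≡1+m (λ i i' → F-reflect (suc k) k i i' 1+k+k≡m))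
                                (trans (cong (λ x → ∑< x (F m k)) (ℕₚ.+-comm d t)) (∑<-+ t d (F m k)))))
  tail-bound : ∀ i → i < t → t + (d + i) ≤ m
  tail-bound i i<t = ℕₚ.≤-pred (subst (t + (d + i) <_) t+d+t≡1+m (ℕₚ.+-monoʳ-< t (ℕₚ.+-monoʳ-< d i<t)))
  2k≤m : 2 * k ≤ m
  2k≤m = subst (2 * k ≤_) 1+2k≡m (ℕₚ.n≤1+n _)
  column-le : ∀ i → i < t → F↓ m k i ≤ F m k i
  column-le i i<t = proj₁ (col k i (ℕₚ.≤-trans (ℕₚ.≤-trans (ℕₚ.m≤n+m i d) (ℕₚ.m≤n+m (d + i) t)) (tail-bound i i<t)) (inj₁ 2k≤m))
  Q≤P : Q ≤ P
  Q≤P = ∑<-mono t column-le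
  Q<P : 1 ≤ t → Q < P
  Q<P 1≤t = ∑<-mono-< t column-le 0 1≤t
    (proj₂ (col k 0 z≤n (inj₁ 2k≤m)) (λ (2k≡m , _) → ℕₚ.1+n≢n (trans 1+2k≡m (sym 2k≡m))) (λ _ → refl))
  H≤P : H ≤ P
  H≤P = ∑<-mono t (λ i i<t → row-antitone row (subst (2 * k <_) 1+2k≡m ℕₚ.≤-refl) (t + (d + i))
          (ℕₚ.≤-trans (ℕₚ.m≤n+m i d) (ℕₚ.m≤n+m (d + i) t)) (tail-bound i i<t))

-- At an odd level the two sums share all blocks but one, where the column step at m is strict.
columnStep-odd-high : ∀ {m k t} → ColumnStep m → 2 * k ≡ m → suc (suc m) ≤ 2 * t → t ≤ suc m →
                      F (suc m) k t < F (suc m) (suc k) t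
columnStep-odd-high {zero}  {zero}  {suc zero}      _ _ _ _           = s≤s z≤n
columnStep-odd-high {zero}  {zero}  {suc (suc _)}   _ _ _ (s≤s ())
columnStep-odd-high {suc m'} {k}    {t}             col 2k≡m 2+m≤2t t≤1+m =
  subst₂ _<_ (sym F-k) (sym F-1+k) (begin-strict
    Qc + Qd + Pc  ≡⟨ xy∙z≈zy∙x Qc Qd Pc ⟩
    Pc + Qd + Qc  <⟨ ℕₚ.+-monoˡ-< Qc (ℕₚ.+-monoʳ-< Pc Qd<Pd) ⟩
    Pc + Pd + Qc  ∎)
  where
  open ℕₚ.≤-Reasoning
  m c : ℕ
  m = suc m'
  c = suc m ∸ t
  t+c≡1+m : t + c ≡ suc m
  t+c≡1+m = ℕₚ.m+[n∸m]≡n t≤1+m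
  1+c≤t : suc c ≤ t
  1+c≤t = ℕₚ.+-cancelˡ-≤ t (suc c) t (subst₂ _≤_ (sym (ℕₚ.+-suc t c)) (cong (t +_) (ℕₚ.+-identityʳ t))
            (subst (λ x → suc x ≤ 2 * t) (sym t+c≡1+m) 2+m≤2t))
  d : ℕ
  d = t ∸ suc c
  c+1+d≡t : c + suc d ≡ t
  c+1+d≡t = trans (ℕₚ.+-suc c d) (ℕₚ.m+[n∸m]≡n 1+c≤t)
  k+k≡m : k + k ≡ m
  k+k≡m = trans (cong (k +_) (sym (ℕₚ.+-identityʳ k))) 2k≡m
  Qc Qd Pc Pd : ℕ
  Qc = ∑< c (F↓ m k)
  Qd = ∑< (suc d) (λ i → F↓ m k (c + i))
  Pc = ∑< c (F m k)
  Pd = ∑< (suc d) (λ i → F m k (c + i))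
  F-k : F (suc m) k t ≡ Qc + Qd + Pc
  F-k = trans (F-split m k t t+c≡1+m)
          (cong₂ _+_ (trans (cong (λ x → ∑< x (F↓ m k)) (sym c+1+d≡t)) (∑<-+ c (suc d) (F↓ m k)))
                     (∑<-reflect-tail m t (F m k) (F m k) t+c≡1+m (λ i i' → F-reflect k k i i' k+k≡m)))
  F-1+k : F (suc m) (suc k) t ≡ Pc + Pd + Qc
  F-1+k = trans (F-split m (suc k) t t+c≡1+m)
            (cong₂ _+_ (trans (cong (λ x → ∑< x (F m k)) (sym c+1+d≡t)) (∑<-+ c (suc d) (F m k)))
                       (∑<-reflect-tail m t (F m (suc k)) (F↓ m k) t+c≡1+m (λ i i' → F-reflect↓ (suc k) k i i' (cong suc k+k≡m))))
  2k≤m : 2 * k ≤ m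
  2k≤m = ℕₚ.≤-reflexive 2k≡m
  index-bound : ∀ i → i < suc d → c + i ≤ m
  index-bound i i<1+d = ℕₚ.≤-pred (ℕₚ.≤-trans (ℕₚ.+-monoʳ-< c i<1+d) (subst (_≤ suc m) (sym c+1+d≡t) t≤1+m))
  Qd<Pd : Qd < Pd
  Qd<Pd = ∑<-mono-< (suc d) (λ i i<1+d → proj₁ (col k (c + i) (index-bound i i<1+d) (inj₁ 2k≤m))) d ℕₚ.≤-refl
            (proj₂ (col k (c + d) (index-bound d ℕₚ.≤-refl) (inj₁ 2k≤m)) not-first-column k≡0⇒c+d≡0)
    where
    not-first-column : ¬ (2 * k ≡ m × c + d ≡ 0)
    not-first-column (_ , c+d≡0) = ℕₚ.<⇒≱ 2+m≤2t (subst (λ x → 2 * x ≤ 2 + m') (sym t≡1) (ℕₚ.m≤m+n 2 m'))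
      where
      t≡1 : t ≡ 1
      t≡1 = trans (sym c+1+d≡t) (trans (ℕₚ.+-suc c d) (cong suc c+d≡0))
    k≡0⇒c+d≡0 : k ≡ 0 → c + d ≡ 0
    k≡0⇒c+d≡0 refl = ⊥-elim (ℕₚ.0≢1+n 2k≡m)

columnStep-below-center : ∀ {m k} → ColumnStep m → 2 * suc k ≤ m → ∀ t → F (suc m) k t < F (suc m) (suc k) t
columnStep-below-center {m} {k} col 2+2k≤m t = strict t
  where
  2k<m : 2 * k < m
  2k<m = ℕₚ.≤-trans (ℕₚ.n≤1+n _) (subst (_≤ m) (2*-suc k) 2+2k≤m)
  2k≤m : 2 * k ≤ m
  2k≤m = ℕₚ.<⇒≤ 2k<m
  1≤m : 1 ≤ m
  1≤m = ℕₚ.≤-trans (s≤s z≤n) 2+2k≤m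
  termwise : ∀ t i → i < suc m → Fnext m k (does (i <? t)) i ≤ Fnext m (suc k) (does (i <? t)) i
  termwise t = Fnext-mono col k t (λ _ _ _ → inj₁ 2k≤m) (λ _ _ _ → inj₁ 2+2k≤m)
  strict : ∀ t → F (suc m) k t < F (suc m) (suc k) t
  strict zero    = ∑<-mono-< (suc m) (termwise zero) 1 (s≤s 1≤m)
    (proj₂ (col (suc k) 1 1≤m (inj₁ 2+2k≤m)) (λ ()) (λ ()))
  strict (suc t) = ∑<-mono-< (suc m) (termwise (suc t)) 0 (s≤s z≤n)
    (proj₂ (col k 0 z≤n (inj₁ 2k≤m)) (λ (2k≡m , _) → ℕₚ.<-irrefl 2k≡m 2k<m) (λ _ → refl))

columnStep-center-high : ∀ {m k} → ColumnStep m → 2 * suc k ≡ suc m → ∀ {t} → suc m ≤ 2 * t →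
  F (suc m) k t ≤ F (suc m) (suc k) t × (1 ≤ t → F (suc m) k t < F (suc m) (suc k) t)
columnStep-center-high {m} {k} col 2+2k≡1+m {t} 1+m≤2t = ∑<-mono (suc m) termwise , strict
  where
  1+2k≡m : suc (2 * k) ≡ m
  1+2k≡m = ℕₚ.suc-injective (trans (sym (2*-suc k)) 2+2k≡1+m)
  2k≤m : 2 * k ≤ m
  2k≤m = subst (2 * k ≤_) 1+2k≡m (ℕₚ.n≤1+n _)
  termwise : ∀ i → i < suc m → Fnext m k (does (i <? t)) i ≤ Fnext m (suc k) (does (i <? t)) i
  termwise = Fnext-mono col k t (λ _ _ _ → inj₁ 2k≤m) (λ i _ t≤i → inj₂ (2+2k≡1+m , ℕₚ.≤-trans 1+m≤2t (ℕₚ.*-monoʳ-≤ 2 t≤i)))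
  strict : 1 ≤ t → F (suc m) k t < F (suc m) (suc k) t
  strict 1≤t = ∑<-mono-< (suc m) termwise 0 (s≤s z≤n) first-term
    where
    first-term : Fnext m k (does (0 <? t)) 0 < Fnext m (suc k) (does (0 <? t)) 0
    first-term rewrite dec-true (0 <? t) 1≤t =
      proj₂ (col k 0 z≤n (inj₁ 2k≤m)) (λ (2k≡m , _) → ℕₚ.1+n≢n (trans 1+2k≡m (sym 2k≡m))) (λ _ → refl)

columnStep-center : ∀ {m k} → ColumnStep m → RowStep m → 2 * suc k ≡ suc m → ∀ t →
  F (suc m) k t ≤ F (suc m) (suc k) t × (1 ≤ t → F (suc m) k t < F (suc m) (suc k) t)
columnStep-center {m} {k} col row 2+2k≡1+m t with suc m ≤? 2 * t
... | yes 1+m≤2t = columnStep-center-high col 2+2k≡1+m 1+m≤2t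
... | no  1+m≰2t = columnStep-center-low col row (ℕₚ.suc-injective (trans (sym (2*-suc k)) 2+2k≡1+m)) t (suc m ∸ (t + t))
                     (trans (shuffle t (suc m ∸ (t + t))) (ℕₚ.m∸n+n≡m 2t≤1+m))
  where
  2t≤1+m : t + t ≤ suc m
  2t≤1+m = subst (_≤ suc m) (cong (t +_) (ℕₚ.+-identityʳ t)) (ℕₚ.<⇒≤ (ℕₚ.≰⇒> 1+m≰2t))
  shuffle : ∀ t d → t + (d + t) ≡ d + (t + t)
  shuffle = solve-∀

columnStep-suc : ∀ m → ColumnStep m → RowStep m → ColumnStep (suc m)
columnStep-suc m col row zero    t _     _ = z≤n , λ _ k≡0⇒t≡0 → subst (λ x → 0 < F (suc m) 0 x) (sym (k≡0⇒t≡0 refl)) (0<F-0-0 (suc m))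
columnStep-suc m col row (suc k) t t≤1+m (inj₂ (2+2k≡2+m , 2+m≤2t)) = ℕₚ.<⇒≤ odd-high , λ _ _ → odd-high
  where
  odd-high : F (suc m) k t < F (suc m) (suc k) t
  odd-high = columnStep-odd-high col (ℕₚ.suc-injective (ℕₚ.suc-injective (trans (sym (2*-suc k)) 2+2k≡2+m))) 2+m≤2t t≤1+m
columnStep-suc m col row (suc k) t t≤1+m (inj₁ 2+2k≤1+m) with ℕₚ.m≤n⇒m<n∨m≡n 2+2k≤1+m
... | inj₁ (s≤s 2+2k≤m) = ℕₚ.<⇒≤ below , λ _ _ → below
  where
  below : F (suc m) k t < F (suc m) (suc k) t
  below = columnStep-below-center col 2+2k≤m t
... | inj₂ 2+2k≡1+m = proj₁ center , λ not-center _ → proj₂ center (ℕₚ.n≢0⇒n>0 (λ t≡0 → not-center (2+2k≡1+m , t≡0)))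
  where
  center : F (suc m) k t ≤ F (suc m) (suc k) t × (1 ≤ t → F (suc m) k t < F (suc m) (suc k) t)
  center = columnStep-center col row 2+2k≡1+m t

columnStep-zero : ColumnStep 0
columnStep-zero zero    zero z≤n _                = z≤n , λ _ _ → s≤s z≤n
columnStep-zero (suc k) zero z≤n (inj₁ ())
columnStep-zero (suc k) zero z≤n (inj₂ (_ , ()))

rowStep-zero : RowStep 0
rowStep-zero k j       (inj₁ (_ , 1≤j , j≤0)) with () ← ℕₚ.≤-trans 1≤j j≤0
rowStep-zero k zero    (inj₂ (_ , () , _))
rowStep-zero k (suc j) (inj₂ (_ , _ , ()))

column-and-row-steps : ∀ n → ColumnStep n × RowStep n
column-and-row-steps zero    = columnStep-zero , rowStep-zero
column-and-row-steps (suc m) with col , row ← column-and-row-steps m = columnStep-suc m col row , rowStep-suc m col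

module _ {R : ℕ → ℕ → Set} where

  applyDownFrom-++-linked : ∀ (f : ℕ → ℕ) c {y T} → (∀ j → suc j < c → R (f (suc j)) (f j)) → (0 < c → R (f 0) y) →
                            Linked R (y ∷ T) → Linked R (applyDownFrom f c ++ y ∷ T)
  applyDownFrom-++-linked f zero          step last linked = linked
  applyDownFrom-++-linked f (suc zero)    step last linked = last (s≤s z≤n) ∷ linked
  applyDownFrom-++-linked f (suc (suc c)) step last linked =
    step c ℕₚ.≤-refl ∷ applyDownFrom-++-linked f (suc c) (λ j 1+j<1+c → step j (ℕₚ.m<n⇒m<1+n 1+j<1+c)) (λ _ → last (s≤s z≤n)) linked

applyDownFrom-cong : ∀ {f g : ℕ → ℕ} c → (∀ j → j < c → f j ≡ g j) → applyDownFrom f c ≡ applyDownFrom g c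
applyDownFrom-cong zero    f≡g = refl
applyDownFrom-cong (suc c) f≡g = cong₂ _∷_ (f≡g c ℕₚ.≤-refl) (applyDownFrom-cong c (λ j j<c → f≡g j (ℕₚ.m<n⇒m<1+n j<c)))

applyDownFrom-+ : ∀ (f : ℕ → ℕ) a b → applyDownFrom f (a + b) ≡ applyDownFrom (λ i → f (i + b)) a ++ applyDownFrom f b
applyDownFrom-+ f zero    b = refl
applyDownFrom-+ f (suc a) b = cong (f (a + b) ∷_) (applyDownFrom-+ f a b)

take-length-++-∷ : ∀ (xs : List ℕ) y ys → take (suc (length xs)) (xs ++ y ∷ ys) ≡ xs ++ [ y ]
take-length-++-∷ []       y ys = refl
take-length-++-∷ (x ∷ xs) y ys = cong (x ∷_) (take-length-++-∷ xs y ys)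

drop-length-++ : ∀ (xs : List ℕ) ys → drop (length xs) (xs ++ ys) ≡ ys
drop-length-++ []       ys = refl
drop-length-++ (x ∷ xs) ys = drop-length-++ xs ys

unimodal-at : ∀ xs y ys → Linked _≤_ (xs ++ [ y ]) → Linked _≥_ (y ∷ ys) → Unimodal (xs ++ y ∷ ys)
unimodal-at xs y ys rising falling =
  length xs , subst (Linked _≤_) (sym (take-length-++-∷ xs y ys)) rising , subst (Linked _≥_) (sym (drop-length-++ xs (y ∷ ys))) falling

parity : ∀ n → (∃[ m ] n ≡ m + m) ⊎ (∃[ m ] n ≡ suc (m + m))
parity zero    = inj₁ (0 , refl)
parity (suc n) with parity n
... | inj₁ (m , n≡m+m)   = inj₂ (m , cong suc n≡m+m)
... | inj₂ (m , n≡1+m+m) = inj₁ (suc m , trans (cong suc n≡1+m+m) (cong suc (sym (ℕₚ.+-suc m m))))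

module Shape (l : ℕ) where

  n : ℕ
  n = suc l

  row-step : RowStep n
  row-step = proj₂ (column-and-row-steps n)

  row-max : ∀ {k} j → 2 * k < n → j ≤ n → F n k j ≤ F n k 0
  row-max j 2k<n j≤n = row-antitone row-step 2k<n j z≤n j≤n

  column-chain : ∀ {k} k' → k ≤ k' → 2 * k' < n → F n k 0 ≤ F n k' 0
  column-chain k' k≤k' 2k'<n with ℕₚ.m≤n⇒m<n∨m≡n k≤k'
  ... | inj₂ refl = ℕₚ.≤-refl
  column-chain (suc k') _ 2+2k'<n | inj₁ (s≤s k≤k') = begin
    F n _ 0          ≤⟨ column-chain k' k≤k' (ℕₚ.≤-trans (s≤s (ℕₚ.*-monoʳ-≤ 2 (ℕₚ.n≤1+n k'))) 2+2k'<n) ⟩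
    F n k' 0         ≡⟨ F-row-link l k' ⟩
    F n (suc k') n   ≤⟨ row-max n 2+2k'<n ℕₚ.≤-refl ⟩
    F n (suc k') 0   ∎
    where open ℕₚ.≤-Reasoning

  F-complement : ∀ {k j} → k ≤ n → j ≤ n → F n k j ≡ F n (n ∸ k) (n ∸ j)
  F-complement {k} {j} k≤n j≤n = F-reflect k (n ∸ k) j (n ∸ j) (ℕₚ.m+[n∸m]≡n k≤n) (ℕₚ.m+[n∸m]≡n j≤n)

  complement-below-center : ∀ {k} → k ≤ n → n < 2 * k → 2 * (n ∸ k) < n
  complement-below-center {k} k≤n n<2k = ℕₚ.+-cancelʳ-< n (2 * (n ∸ k)) n (begin-strict
    2 * (n ∸ k) + n          <⟨ ℕₚ.+-monoʳ-< (2 * (n ∸ k)) n<2k ⟩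
    2 * (n ∸ k) + 2 * k      ≡⟨ sym (ℕₚ.*-distribˡ-+ 2 (n ∸ k) k) ⟩
    2 * (n ∸ k + k)          ≡⟨ cong (2 *_) (ℕₚ.m∸n+n≡m k≤n) ⟩
    2 * n                    ≡⟨ cong (n +_) (ℕₚ.+-identityʳ n) ⟩
    n + n                    ∎)
    where open ℕₚ.≤-Reasoning

  bounded-by-complement : ∀ {k j M} → (∀ k j → 2 * k < n → j ≤ n → F n k j ≤ M) →
                          k ≤ n → n < 2 * k → j ≤ n → F n k j ≤ M
  bounded-by-complement {k} {j} {M} low k≤n n<2k j≤n =
    subst (_≤ M) (sym (F-complement k≤n j≤n)) (low (n ∸ k) (n ∸ j) (complement-below-center k≤n n<2k) (ℕₚ.m∸n≤m n j))

  maximum-odd : ∀ m → n ≡ 2 * m + 1 → (F n m 0 ≡ F n (m + 1) n) × (∀ k j → k ≤ n → j ≤ n → F n k j ≤ F n m 0)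
  maximum-odd m n≡1+2m = trans (F-row-link l m) (cong (λ x → F n x n) (ℕₚ.+-comm 1 m)) , bound
    where
    n≡suc-2m : n ≡ suc (2 * m)
    n≡suc-2m = trans n≡1+2m (ℕₚ.+-comm (2 * m) 1)
    2m<n : 2 * m < n
    2m<n = ℕₚ.≤-reflexive (sym n≡suc-2m)
    low : ∀ k j → 2 * k < n → j ≤ n → F n k j ≤ F n m 0
    low k j 2k<n j≤n = ℕₚ.≤-trans (row-max j 2k<n j≤n) (column-chain m k≤m 2m<n)
      where
      k≤m : k ≤ m
      k≤m = ℕₚ.*-cancelˡ-≤ 2 (ℕₚ.≤-pred (subst (2 * k <_) n≡suc-2m 2k<n))
    bound : ∀ k j → k ≤ n → j ≤ n → F n k j ≤ F n m 0
    bound k j k≤n j≤n with ℕₚ.≤-<-connex k m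
    ... | inj₁ k≤m = low k j (ℕₚ.≤-<-trans (ℕₚ.*-monoʳ-≤ 2 k≤m) 2m<n) j≤n
    ... | inj₂ m<k = bounded-by-complement low k≤n n<2k j≤n
      where
      n<2k : n < 2 * k
      n<2k = subst (_≤ 2 * k) (trans (2*-suc m) (cong suc (sym n≡suc-2m))) (ℕₚ.*-monoʳ-≤ 2 m<k)

  center-row-step : ∀ {m} → n ≡ 2 * m → ∀ {j} → m ≤ j → suc j ≤ n → F n m (suc j) ≤ F n m j
  center-row-step {m} n≡2m {j} m≤j 1+j≤n =
    proj₁ (row-step m (suc j) (inj₂ (sym n≡2m , subst (_< 2 * suc j) (sym n≡2m) (ℕₚ.*-monoʳ-< 2 (s≤s m≤j)) , 1+j≤n)))

  center-row-step-left : ∀ {m} → n ≡ 2 * m → ∀ {j} → j < m → F n m j ≤ F n m (suc j)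
  center-row-step-left {m} n≡2m {j} j<m =
    subst₂ _≤_ (sym (F-reflect m m j (n ∸ j) m+m≡n (ℕₚ.m+[n∸m]≡n (ℕₚ.<⇒≤ 1+j≤n)))) (sym (F-reflect m m (suc j) (n ∸ suc j) m+m≡n (ℕₚ.m+[n∸m]≡n 1+j≤n)))
      (subst (λ x → F n m x ≤ F n m (n ∸ suc j)) (sym (ℕₚ.+-∸-assoc 1 1+j≤n)) (center-row-step n≡2m m≤n∸1+j (s≤s (ℕₚ.m∸n≤m l j))))
    where
    m+m≡n : m + m ≡ n
    m+m≡n = trans (cong (m +_) (sym (ℕₚ.+-identityʳ m))) (sym n≡2m)
    1+j≤n : suc j ≤ n
    1+j≤n = ℕₚ.≤-trans j<m (subst (m ≤_) m+m≡n (ℕₚ.m≤m+n m m))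
    m≤n∸1+j : m ≤ n ∸ suc j
    m≤n∸1+j = ℕₚ.m+n≤o⇒m≤o∸n m (subst (m + suc j ≤_) m+m≡n (ℕₚ.+-monoʳ-≤ m j<m))

  center-row-peak : ∀ {m} → n ≡ 2 * m → ∀ j → m ≤ j → j ≤ n → F n m j ≤ F n m m
  center-row-peak n≡2m j m≤j j≤n with ℕₚ.m≤n⇒m<n∨m≡n m≤j
  ... | inj₂ refl = ℕₚ.≤-refl
  center-row-peak n≡2m (suc j) _ 1+j≤n | inj₁ (s≤s m≤j) =
    ℕₚ.≤-trans (center-row-step n≡2m m≤j 1+j≤n) (center-row-peak n≡2m j m≤j (ℕₚ.<⇒≤ 1+j≤n))

  maximum-even : ∀ m → n ≡ 2 * m → ∀ k j → k ≤ n → j ≤ n → F n k j ≤ F n m m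
  maximum-even zero    ()
  maximum-even (suc m) n≡2M = bound
    where
    M : ℕ
    M = suc m
    M+M≡n : M + M ≡ n
    M+M≡n = trans (cong (M +_) (sym (ℕₚ.+-identityʳ M))) (sym n≡2M)
    low : ∀ k j → 2 * k < n → j ≤ n → F n k j ≤ F n M M
    low k j 2k<n j≤n = begin
      F n k j   ≤⟨ row-max j 2k<n j≤n ⟩
      F n k 0   ≤⟨ column-chain m (ℕₚ.≤-pred (ℕₚ.*-cancelˡ-< 2 k M (subst (2 * k <_) n≡2M 2k<n))) 2m<n ⟩
      F n m 0   ≡⟨ F-row-link l m ⟩
      F n M n   ≤⟨ center-row-peak n≡2M n (ℕₚ.m+n≤o⇒m≤o M (ℕₚ.≤-reflexive M+M≡n)) ℕₚ.≤-refl ⟩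
      F n M M   ∎
      where
      open ℕₚ.≤-Reasoning
      2m<n : 2 * m < n
      2m<n = subst (2 * m <_) (sym n≡2M) (ℕₚ.*-monoʳ-< 2 ℕₚ.≤-refl)
    bound : ∀ k j → k ≤ n → j ≤ n → F n k j ≤ F n M M
    bound k j k≤n j≤n with ℕₚ.<-cmp k M
    ... | tri< k<M _ _  = low k j (subst (2 * k <_) (sym n≡2M) (ℕₚ.*-monoʳ-< 2 k<M)) j≤n
    ... | tri> _ _ M<k  = bounded-by-complement low k≤n (subst (_< 2 * k) (sym n≡2M) (ℕₚ.*-monoʳ-< 2 M<k)) j≤n
    ... | tri≈ _ refl _ with ℕₚ.≤-total M j
    ...   | inj₁ M≤j = center-row-peak n≡2M j M≤j j≤n
    ...   | inj₂ j≤M = subst (_≤ F n M M) (sym (F-reflect M M j (n ∸ j) M+M≡n (ℕₚ.m+[n∸m]≡n j≤n)))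
                         (center-row-peak n≡2M (n ∸ j) M≤n∸j (ℕₚ.m∸n≤m n j))
      where
      M≤n∸j : M ≤ n ∸ j
      M≤n∸j = ℕₚ.m+n≤o⇒m≤o∸n M (ℕₚ.≤-trans (ℕₚ.+-monoʳ-≤ M j≤M) (ℕₚ.≤-reflexive M+M≡n))

  row : ℕ → List ℕ
  row k = applyDownFrom (F n k) (suc n)

  rows : ℕ → ℕ → List ℕ
  rows a zero    = []
  rows a (suc c) = row a ++ rows (suc a) c

  rows-+ : ∀ a b c → rows a (b + c) ≡ rows a b ++ rows (a + b) c
  rows-+ a zero    c = cong (λ x → rows x c) (sym (ℕₚ.+-identityʳ a))
  rows-+ a (suc b) c = begin
    row a ++ rows (suc a) (b + c)                ≡⟨ cong (row a ++_) (rows-+ (suc a) b c) ⟩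
    row a ++ (rows (suc a) b ++ rows (suc a + b) c) ≡⟨ Listₚ.++-assoc (row a) _ _ ⟨
    (row a ++ rows (suc a) b) ++ rows (suc a + b) c ≡⟨ cong (λ x → (row a ++ rows (suc a) b) ++ rows x c) (sym (ℕₚ.+-suc a b)) ⟩
    (row a ++ rows (suc a) b) ++ rows (a + suc b) c ∎
    where open ≡-Reasoning

  rising-row : ∀ {k} → 2 * k < n → ∀ j → suc j < suc n → F n k (suc j) ≤ F n k j
  rising-row {k} 2k<n j 1+j<1+n = proj₁ (row-step k (suc j) (inj₁ (2k<n , s≤s z≤n , ℕₚ.≤-pred 1+j<1+n)))

  falling-row : ∀ {k} → n < 2 * k → k ≤ n → ∀ j → suc j < suc n → F n k j ≤ F n k (suc j)
  falling-row {k} n<2k k≤n j 1+j<1+n =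
    subst₂ _≤_ (sym (F-complement k≤n (ℕₚ.<⇒≤ 1+j≤n))) (sym (F-complement k≤n 1+j≤n))
      (row-antitone row-step (complement-below-center k≤n n<2k) (n ∸ j) (ℕₚ.∸-monoʳ-≤ n (ℕₚ.n≤1+n j)) (ℕₚ.m∸n≤m n j))
    where
    1+j≤n : suc j ≤ n
    1+j≤n = ℕₚ.≤-pred 1+j<1+n

  rising-rows : ∀ a c {y T} → (∀ i → i ≤ c → 2 * (a + i) < n) → F n (a + c) 0 ≤ y → Linked _≤_ (y ∷ T) →
                Linked _≤_ (rows a (suc c) ++ y ∷ T)
  rising-rows a zero    {y} {T} below end≤y linked =
    subst (Linked _≤_) (sym (Listₚ.++-assoc (row a) [] (y ∷ T)))
      (applyDownFrom-++-linked (F n a) (suc n) (rising-row (subst (λ x → 2 * x < n) (ℕₚ.+-identityʳ a) (below 0 z≤n)))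
         (λ _ → subst (λ x → F n x 0 ≤ y) (ℕₚ.+-identityʳ a) end≤y) linked)
  rising-rows a (suc c) {y} {T} below end≤y linked =
    subst (Linked _≤_) (sym (Listₚ.++-assoc (row a) (rows (suc a) (suc c)) (y ∷ T)))
      (applyDownFrom-++-linked (F n a) (suc n) (rising-row (subst (λ x → 2 * x < n) (ℕₚ.+-identityʳ a) (below 0 z≤n)))
         (λ _ → ℕₚ.≤-reflexive (F-row-link l a))
         (rising-rows (suc a) c (λ i i≤c → subst (λ x → 2 * x < n) (ℕₚ.+-suc a i) (below (suc i) (s≤s i≤c)))
            (subst (λ x → F n x 0 ≤ y) (ℕₚ.+-suc a c) end≤y) linked))

  first-row-falls : ∀ a {c} → (∀ i → i < suc c → n < 2 * (a + i) × a + i ≤ n) → ∀ j → suc j < suc n → F n a j ≤ F n a (suc j)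
  first-row-falls a above = falling-row (subst (λ x → n < 2 * x) (ℕₚ.+-identityʳ a) (proj₁ (above 0 (s≤s z≤n))))
                                        (subst (_≤ n) (ℕₚ.+-identityʳ a) (proj₂ (above 0 (s≤s z≤n))))

  falling-rows : ∀ a c → (∀ i → i < c → n < 2 * (a + i) × a + i ≤ n) → Linked _≥_ (rows a c)
  falling-rows a zero          above = []
  falling-rows a (suc zero)    above =
    subst (Linked _≥_) (sym (Listₚ.++-identityʳ (row a))) (applyDownFrom⁺₁ (F n a) (suc n) (λ {j} → first-row-falls a above j))
  falling-rows a (suc (suc c)) above =
    applyDownFrom-++-linked (F n a) (suc n) (first-row-falls a above) (λ _ → ℕₚ.≤-reflexive (sym (F-row-link l a)))
      (falling-rows (suc a) (suc c) (λ i i<1+c → subst (λ x → n < 2 * x × x ≤ n) (ℕₚ.+-suc a i) (above (suc i) (s≤s i<1+c))))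

  unimodal-odd : ∀ m → n ≡ suc (m + m) → Unimodal (rows 0 (suc n))
  unimodal-odd m n≡1+m+m = subst Unimodal (sym split) (unimodal-at (rows 0 (suc m)) (F n (suc m) n) _ rising falling)
    where
    split : rows 0 (suc n) ≡ rows 0 (suc m) ++ rows (suc m) (suc m)
    split = trans (cong (rows 0) (trans (cong suc n≡1+m+m) (sym (ℕₚ.+-suc (suc m) m)))) (rows-+ 0 (suc m) (suc m))
    2m<n : 2 * m < n
    2m<n = subst (2 * m <_) (sym n≡1+m+m) (s≤s (ℕₚ.≤-reflexive (cong (m +_) (ℕₚ.+-identityʳ m))))
    rising : Linked _≤_ (rows 0 (suc m) ++ [ F n (suc m) n ])
    rising = rising-rows 0 m (λ i i≤m → ℕₚ.≤-<-trans (ℕₚ.*-monoʳ-≤ 2 i≤m) 2m<n) (ℕₚ.≤-reflexive (F-row-link l m)) [-]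
    falling : Linked _≥_ (rows (suc m) (suc m))
    falling = falling-rows (suc m) (suc m) (λ i i<1+m → n<2[1+m+i] i , 1+m+i≤n i i<1+m)
      where
      n<2[1+m+i] : ∀ i → n < 2 * (suc m + i)
      n<2[1+m+i] i = subst (_< 2 * (suc m + i)) (sym n≡1+m+m) (ℕₚ.≤-trans (ℕₚ.m≤m+n (suc (suc (m + m))) _) (ℕₚ.≤-reflexive (shape m i)))
        where
        shape : ∀ m i → suc (suc (m + m)) + 2 * i ≡ 2 * (suc m + i)
        shape = solve-∀
      1+m+i≤n : ∀ i → i < suc m → suc m + i ≤ n
      1+m+i≤n i i<1+m = subst (suc m + i ≤_) (sym n≡1+m+m) (ℕₚ.+-monoʳ-≤ (suc m) (ℕₚ.≤-pred i<1+m))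

  module Even (m : ℕ) (n≡M+M : n ≡ suc m + suc m) where

    M : ℕ
    M = suc m

    n≡2M : n ≡ 2 * M
    n≡2M = trans n≡M+M (cong (M +_) (sym (ℕₚ.+-identityʳ M)))

    upper lower : List ℕ
    upper = applyDownFrom (λ i → F n M (i + suc M)) M
    lower = applyDownFrom (F n M) M

    center-row : row M ≡ upper ++ F n M M ∷ lower
    center-row = trans (cong (applyDownFrom (F n M)) (trans (cong suc n≡M+M) (sym (ℕₚ.+-suc M M)))) (applyDownFrom-+ (F n M) M (suc M))

    split : rows 0 (suc n) ≡ (rows 0 M ++ upper) ++ F n M M ∷ (lower ++ rows (suc M) M)
    split = begin
      rows 0 (suc n)                                             ≡⟨ cong (rows 0) (trans (cong suc n≡M+M) (sym (ℕₚ.+-suc M M))) ⟩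
      rows 0 (M + suc M)                                         ≡⟨ rows-+ 0 M (suc M) ⟩
      rows 0 M ++ (row M ++ rows (suc M) M)                      ≡⟨ cong (λ r → rows 0 M ++ (r ++ rows (suc M) M)) center-row ⟩
      rows 0 M ++ ((upper ++ F n M M ∷ lower) ++ rows (suc M) M) ≡⟨ cong (rows 0 M ++_) (Listₚ.++-assoc upper _ _) ⟩
      rows 0 M ++ (upper ++ F n M M ∷ (lower ++ rows (suc M) M)) ≡⟨ Listₚ.++-assoc (rows 0 M) upper _ ⟨
      (rows 0 M ++ upper) ++ F n M M ∷ (lower ++ rows (suc M) M) ∎
      where open ≡-Reasoning

    rising : Linked _≤_ ((rows 0 M ++ upper) ++ [ F n M M ])
    rising = subst (Linked _≤_) (sym (Listₚ.++-assoc (rows 0 M) upper [ F n M M ]))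
      (rising-rows 0 m below-center (ℕₚ.≤-reflexive (trans (F-row-link l m) (cong (F n M) n≡m+1+M)))
        (applyDownFrom-++-linked _ M upper-rises (λ _ → center-row-step n≡2M ℕₚ.≤-refl M<n) [-]))
      where
      below-center : ∀ i → i ≤ m → 2 * i < n
      below-center i i≤m = subst (2 * i <_) (sym n≡2M) (ℕₚ.*-monoʳ-< 2 (s≤s i≤m))
      n≡m+1+M : n ≡ m + suc M
      n≡m+1+M = trans n≡M+M (sym (ℕₚ.+-suc m M))
      M<n : M < n
      M<n = subst (M <_) (sym n≡M+M) (s≤s (ℕₚ.m≤n+m (suc m) m))
      upper-rises : ∀ j → suc j < M → F n M (suc j + suc M) ≤ F n M (j + suc M)
      upper-rises j 1+j<M = center-row-step n≡2M (ℕₚ.≤-trans (ℕₚ.n≤1+n M) (ℕₚ.m≤n+m (suc M) j))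
        (subst₂ _≤_ (sym (ℕₚ.+-suc (suc j) M)) (sym n≡M+M) (ℕₚ.+-monoˡ-≤ M 1+j<M))

    falling : Linked _≥_ (F n M M ∷ (lower ++ rows (suc M) M))
    falling = applyDownFrom-++-linked (F n M) (suc M) (λ j 1+j<1+M → center-row-step-left n≡2M (ℕₚ.≤-pred 1+j<1+M))
                (λ _ → ℕₚ.≤-reflexive (sym (F-row-link l M))) (falling-rows (suc M) M above-center)
      where
      above-center : ∀ i → i < M → n < 2 * (suc M + i) × suc M + i ≤ n
      above-center i i<M = subst (_< 2 * (suc M + i)) (sym n≡2M) (ℕₚ.*-monoʳ-< 2 (s≤s (ℕₚ.m≤m+n M i))) ,
                           subst (suc M + i ≤_) (sym n≡M+M) (ℕₚ.+-monoʳ-< M i<M)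

    unimodal-even : Unimodal (rows 0 (suc n))
    unimodal-even = subst Unimodal (sym split) (unimodal-at (rows 0 M ++ upper) (F n M M) (lower ++ rows (suc M) M) rising falling)

  rows-unimodal : Unimodal (rows 0 (suc n))
  rows-unimodal with parity n
  ... | inj₁ (zero , ())
  ... | inj₁ (suc m , n≡M+M) = Even.unimodal-even m n≡M+M
  ... | inj₂ (m , n≡1+m+m)   = unimodal-odd m n≡1+m+m

b-row-step : ∀ n k j → RowStepHyp n k j → b n k j ≤ b n k (j ∸ 1) × (¬ RowStepTie n k j → b n k j < b n k (j ∸ 1))
b-row-step n k j hyp =
  subst₂ (λ x y → x ≤ y × (¬ RowStepTie n k j → x < y)) (sym (b≡F n k j j≤n)) (sym (b≡F n k (j ∸ 1) (ℕₚ.≤-trans (ℕₚ.m∸n≤m j 1) j≤n)))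
    (proj₂ (column-and-row-steps n) k j hyp)
  where
  j≤n : j ≤ n
  j≤n = RowStepHyp⇒≤ {k = k} hyp

b-column-step : ∀ n k j → (1 ≤ k × 2 * k ≤ n × j ≤ n) ⊎ (2 * k ≡ n + 1 × n + 1 ≤ 2 * j × j ≤ n) →
                b n (k ∸ 1) j ≤ b n k j × (¬ (2 * k ≡ n × j ≡ 0) → b n (k ∸ 1) j < b n k j)
b-column-step n zero    j (inj₁ (() , _))
b-column-step n zero    j (inj₂ (0≡n+1 , _)) = ⊥-elim (ℕₚ.0≢1+n (trans 0≡n+1 (ℕₚ.+-comm n 1)))
b-column-step n (suc k) j hyp =
  subst₂ (λ x y → x ≤ y × (¬ (2 * suc k ≡ n × j ≡ 0) → x < y)) (sym (b≡F n k j (j≤n hyp))) (sym (b≡F n (suc k) j (j≤n hyp)))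
    (proj₁ column , λ not-center → proj₂ column not-center (λ ()))
  where
  j≤n : (1 ≤ suc k × 2 * suc k ≤ n × j ≤ n) ⊎ (2 * suc k ≡ n + 1 × n + 1 ≤ 2 * j × j ≤ n) → j ≤ n
  j≤n (inj₁ (_ , _ , j≤n)) = j≤n
  j≤n (inj₂ (_ , _ , j≤n)) = j≤n
  column-hyp : (1 ≤ suc k × 2 * suc k ≤ n × j ≤ n) ⊎ (2 * suc k ≡ n + 1 × n + 1 ≤ 2 * j × j ≤ n) → ColumnStepHyp n (suc k) j
  column-hyp (inj₁ (_ , 2k≤n , _))         = inj₁ 2k≤n
  column-hyp (inj₂ (2k≡n+1 , n+1≤2j , _)) = inj₂ (trans 2k≡n+1 (ℕₚ.+-comm n 1) , subst (_≤ 2 * j) (ℕₚ.+-comm n 1) n+1≤2j)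
  column : F n k j ≤ F n (suc k) j × (¬ (2 * suc k ≡ n × j ≡ 0) → (suc k ≡ 0 → j ≡ 0) → F n k j < F n (suc k) j)
  column = proj₁ (column-and-row-steps n) (suc k) j (j≤n hyp) (column-hyp hyp)

module _ (l : ℕ) where

  open Shape l

  b-maximum-even : ∀ m → n ≡ 2 * m → ∀ k j → k ≤ n → j ≤ n → b n k j ≤ b n m m
  b-maximum-even m n≡2m k j k≤n j≤n = subst₂ _≤_ (sym (b≡F n k j j≤n)) (sym (b≡F n m m m≤n)) (maximum-even m n≡2m k j k≤n j≤n)
    where
    m≤n : m ≤ n
    m≤n = subst (m ≤_) (sym n≡2m) (ℕₚ.m≤m+n m (m + 0))

  b-maximum-odd : ∀ m → n ≡ 2 * m + 1 → (b n m 0 ≡ b n (m + 1) n) × (∀ k j → k ≤ n → j ≤ n → b n k j ≤ b n m 0)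
  b-maximum-odd m n≡2m+1 with center , bound ← maximum-odd m n≡2m+1 =
    trans (b≡F n m 0 z≤n) (trans center (sym (b≡F n (m + 1) n ℕₚ.≤-refl))) ,
    λ k j k≤n j≤n → subst₂ _≤_ (sym (b≡F n k j j≤n)) (sym (b≡F n m 0 z≤n)) (bound k j k≤n j≤n)

  bSequence≡rows : bSequence n ≡ rows 0 (suc n)
  bSequence≡rows = trans (Listₚ.concatMap-cong row≡ (upTo (suc n))) (concatMap-rows (suc n) 0 (λ _ → refl))
    where
    row≡ : ∀ k → map (λ j → b n k j) (reverse (upTo (suc n))) ≡ row k
    row≡ k = begin
      map (b n k) (reverse (upTo (suc n)))  ≡⟨ cong (map (b n k)) (Listₚ.reverse-upTo (suc n)) ⟩
      map (b n k) (downFrom (suc n))        ≡⟨ Listₚ.map-downFrom (b n k) (suc n) ⟩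
      applyDownFrom (b n k) (suc n)         ≡⟨ applyDownFrom-cong (suc n) (λ j j<1+n → b≡F n k j (ℕₚ.≤-pred j<1+n)) ⟩
      row k                                 ∎
      where open ≡-Reasoning
    concatMap-rows : ∀ c a {h : ℕ → ℕ} → (∀ i → h i ≡ a + i) → concatMap row (applyUpTo h c) ≡ rows a c
    concatMap-rows zero    a h≡ = refl
    concatMap-rows (suc c) a h≡ =
      cong₂ _++_ (cong row (trans (h≡ 0) (ℕₚ.+-identityʳ a))) (concatMap-rows c (suc a) (λ i → trans (h≡ (suc i)) (ℕₚ.+-suc a i)))

  bSequence-unimodal : Unimodal (bSequence n)
  bSequence-unimodal = subst Unimodal (sym bSequence≡rows) rows-unimodal

proposition5p2 : (n : ℕ) → 1 ≤ n →
  -- (a)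
  ((k j : ℕ) →
     ((2 * k < n × 1 ≤ j × j ≤ n) ⊎ (2 * k ≡ n × n < 2 * j × j ≤ n)) →
     (b n k j ≤ b n k (j ∸ 1))
     × (¬ ((k ≡ 0 × 2 ≤ j × j ≤ n) ⊎ (2 * k + 1 ≡ n × j ≡ 1)) →
        b n k j < b n k (j ∸ 1)))
  ×
  -- (b)
  ((k j : ℕ) →
     ((1 ≤ k × 2 * k ≤ n × j ≤ n) ⊎ (2 * k ≡ n + 1 × n + 1 ≤ 2 * j × j ≤ n)) →
     (b n (k ∸ 1) j ≤ b n k j)
     × (¬ (2 * k ≡ n × j ≡ 0) → b n (k ∸ 1) j < b n k j))
  ×
  -- (c)
  (Unimodal (bSequence n)
   × ((m : ℕ) → n ≡ 2 * m →
        (k j : ℕ) → k ≤ n → j ≤ n → b n k j ≤ b n m m)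
   × ((m : ℕ) → n ≡ 2 * m + 1 →
        (b n m 0 ≡ b n (m + 1) n)
        × ((k j : ℕ) → k ≤ n → j ≤ n → b n k j ≤ b n m 0)))
proposition5p2 zero    ()
proposition5p2 (suc l) _ =
  b-row-step (suc l) , b-column-step (suc l) , bSequence-unimodal l , b-maximum-even l , b-maximum-odd l
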